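{- Let $SC_3(x)=\sum_{n\ge0} sc_3(\mathcal{D}_n)x^n$, where $sc_3(\mathcal{D}_n)$ is the number of saturated chains of length 3 in $\mathcal{D}_n$. Let $A(q,x)$, $B(q,x)$, $C(q,x)$ be the generating series of all Dyck paths where $x$ marks semilength and $q$ marks occurrences of the factor $dduu$, $dudu$, $duuu$ respectively; let $V(q,x)$ be the generating series of Dyck paths where $x$ marks semilength and $q$ marks occurrences of $du$; and let $F(y,q,x)$ be the generating series of Dyck paths where $x$ marks semilength, $q$ marks occurrences of $duu$ and $y$ marks occurrences of $du$. Then $$SC_3(x)=2\left[\frac{\partial A}{\partial q}\right]_{q=1}+2\left[\frac{\partial B}{\partial q}\right]_{q=1}+2\left[\frac{\partial C}{\partial q}\right]_{q=1}+\left[\frac{\partial^3 V}{\partial q^3}\right]_{q=1}+6\left[\frac{\partial^2 F}{\partial y\,\partial q}-\frac{\partial F}{\partial q}\right]_{y=q=1}.$$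
   Context: A Dyck path of semilength $n$ is a word in $u$ (step $(1,1)$) and $d$ (step $(1,-1)$) with $n$ of each letter whose path from the origin never goes below the $x$-axis. $\mathcal{D}_n$ is the set of such paths ordered by $\gamma\le\gamma'$ iff $\gamma$ lies weakly below $\gamma'$. A saturated chain of length $h$ is a chain $\gamma^{(0)}<\cdots<\gamma^{(h)}$ where each element covers the previous one. -}

module Defs where

open import Data.Nat using (ℕ; zero; suc; _+_; _*_; _≤ᵇ_; _≡ᵇ_)
open import Data.Bool using (Bool; true; false; _∧_; _∨_; not; if_then_else_)
open import Data.List using (List; []; _∷_; _++_; map; foldr; replicate; concatMap; filter; length)
open import Data.Bool.ListAction using (any)
open import Data.Nat.ListAction using (sum)
open import Data.Integer using (ℤ; +_) renaming (_+_ to _+ℤ_; _*_ to _*ℤ_; _-_ to _-ℤ_)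

data Step : Set where
  u d : Step

_==S_ : Step → Step → Bool
u ==S u = true
d ==S d = true
_ ==S _ = false

Word : Set
Word = List Step

words : ℕ → List Word
words zero    = [] ∷ []
words (suc k) = concatMap (λ w → (u ∷ w) ∷ (d ∷ w) ∷ []) (words k)

dyckFrom : ℕ → Word → Bool
dyckFrom zero    []      = true
dyckFrom (suc _) []      = false
dyckFrom h       (u ∷ w) = dyckFrom (suc h) w
dyckFrom zero    (d ∷ w) = false
dyckFrom (suc h) (d ∷ w) = dyckFrom h w

isDyck : Word → Bool
isDyck = dyckFrom 0

dyck : ℕ → List Word
dyck n = filter (λ w → Data.Bool._≟_ (isDyck w) true) (words (n + n))

-- The order on 𝒟ₙ: γ ≤ γ' iff γ lies weakly below γ'

heights : ℕ → Word → List ℕ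
heights h []      = []
heights h (u ∷ w) = suc h ∷ heights (suc h) w
heights zero    (d ∷ w) = zero ∷ heights zero w   -- never used on Dyck paths
heights (suc h) (d ∷ w) = h ∷ heights h w

allLe : List ℕ → List ℕ → Bool
allLe []       []       = true
allLe (a ∷ as) (b ∷ bs) = (a ≤ᵇ b) ∧ allLe as bs
allLe _        _        = false

leqD : Word → Word → Bool
leqD γ γ' = allLe (heights 0 γ) (heights 0 γ')

eqW : Word → Word → Bool
eqW []       []       = true
eqW (a ∷ as) (b ∷ bs) = (a ==S b) ∧ eqW as bs
eqW _        _        = false

ltD : Word → Word → Bool
ltD γ γ' = leqD γ γ' ∧ not (eqW γ γ')

coversD : ℕ → Word → Word → Bool
coversD n γ γ' = ltD γ γ' ∧ not (any (λ δ → ltD γ δ ∧ ltD δ γ') (dyck n))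

boolToℕ : Bool → ℕ
boolToℕ true  = 1
boolToℕ false = 0

sc3 : ℕ → ℕ
sc3 n = sum (map (λ a → sum (map (λ b → sum (map (λ c → sum (map (λ e →
          boolToℕ (coversD n a b ∧ coversD n b c ∧ coversD n c e))
          (dyck n))) (dyck n))) (dyck n))) (dyck n))

isPrefix : Word → Word → Bool
isPrefix []       _        = true
isPrefix (_ ∷ _)  []       = false
isPrefix (a ∷ as) (b ∷ bs) = (a ==S b) ∧ isPrefix as bs

-- number of (possibly overlapping) occurrences of factor p in w
occ : Word → Word → ℕ
occ p []       = 0
occ p (s ∷ w)  = boolToℕ (isPrefix p (s ∷ w)) + occ p w

-- Polynomials with ℕ coefficients (coefficient lists, index = exponent)

Poly : Set
Poly = List ℕ

addP : Poly → Poly → Poly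
addP []      q       = q
addP (a ∷ p) []      = a ∷ p
addP (a ∷ p) (b ∷ q) = (a + b) ∷ addP p q

mono : ℕ → Poly
mono k = replicate k 0 ++ (1 ∷ [])

derivFrom : ℕ → Poly → Poly
derivFrom k []       = []
derivFrom k (c ∷ cs) = (k * c) ∷ derivFrom (suc k) cs

deriv : Poly → Poly
deriv []       = []
deriv (_ ∷ cs) = derivFrom 1 cs

eval1 : Poly → ℕ
eval1 = sum

-- Bivariate polynomials in y, q: outer index = exponent of y
Poly2 : Set
Poly2 = List Poly

addP2 : Poly2 → Poly2 → Poly2
addP2 []      q       = q
addP2 (a ∷ p) []      = a ∷ p
addP2 (a ∷ p) (b ∷ q) = addP a b ∷ addP2 p q

mono2 : ℕ → ℕ → Poly2
mono2 a b = replicate a [] ++ (mono b ∷ [])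

derivFromY : ℕ → Poly2 → Poly2
derivFromY k []       = []
derivFromY k (c ∷ cs) = map (k *_) c ∷ derivFromY (suc k) cs

derivY : Poly2 → Poly2
derivY []       = []
derivY (_ ∷ cs) = derivFromY 1 cs

derivQ : Poly2 → Poly2
derivQ = map deriv

eval11 : Poly2 → ℕ
eval11 p = sum (map sum p)

-- coefficient of xⁿ in  Σ_{γ Dyck} q^{f γ} x^{|γ|/2}
genPoly : (Word → ℕ) → ℕ → Poly
genPoly f n = foldr (λ γ acc → addP (mono (f γ)) acc) [] (dyck n)

-- coefficient of xⁿ in  Σ_{γ Dyck} y^{g γ} q^{f γ} x^{|γ|/2}
genPoly2 : (Word → ℕ) → (Word → ℕ) → ℕ → Poly2
genPoly2 g f n = foldr (λ γ acc → addP2 (mono2 (g γ) (f γ)) acc) [] (dyck n)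

A : ℕ → Poly
A = genPoly (occ (d ∷ d ∷ u ∷ u ∷ []))

B : ℕ → Poly
B = genPoly (occ (d ∷ u ∷ d ∷ u ∷ []))

C : ℕ → Poly
C = genPoly (occ (d ∷ u ∷ u ∷ u ∷ []))

V : ℕ → Poly
V = genPoly (occ (d ∷ u ∷ []))

F : ℕ → Poly2
F = genPoly2 (occ (d ∷ u ∷ [])) (occ (d ∷ u ∷ u ∷ []))

-- A path b covers a in 𝒟ₙ exactly when b arises from a by turning one valley du into a peak ud.
-- Hence sc₃(𝒟ₙ) is the sum over γ ∈ 𝒟ₙ of the number of ways to flip three valleys in succession.
-- Flipping a valley destroys it and creates a new valley on its left (if it is preceded by d) and
-- on its right (if it is followed by u); so from a path with v valleys there are
-- v(v − 1) + #ddu + #duu two-step flip sequences, and, by induction along the path, three-step ones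
-- numbering v(v − 1)(v − 2) + 3(v − 1)(#ddu + #duu) + 2 #dduu + 2 #dudu + #duuu + #dddu.
-- Reflecting paths (reverse, then swap u and d) permutes 𝒟ₙ and exchanges ddu with duu and dddu
-- with duuu, which turns the sum of these counts into the stated combination: the coefficient of xⁿ
-- in ∂ʲ/∂qʲ of a generating series at q = 1 is the sum of the j-th falling factorials of the
-- marked statistic, and ∂²F/∂y∂q at y = q = 1 sums #du · #duu.
module Submission where

open import Defs
open import Data.Nat using (ℕ)

module SaturatedChains where

  open import Data.Nat using (zero; suc; _+_; _*_; _≤_; _≰_; _<_; _≡ᵇ_; z≤n; s≤s)
  open import Data.Nat.Properties
  open import Data.Nat.ListAction using (sum)
  open import Data.Nat.ListAction.Properties using (sum-↭)
  open import Data.Nat.Tactic.RingSolver using (solve-∀)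
  open import Algebra.Properties.CommutativeSemigroup +-commutativeSemigroup using (interchange)
  import Data.Bool
  open import Data.Bool using (Bool; true; false; _∧_; _∨_; not; T)
  open import Data.Bool.Properties using (∧-zeroʳ; ∧-conicalˡ; ∧-conicalʳ; ∨-zeroʳ)
  open import Data.Bool.ListAction using (any)
  open import Data.List using (List; []; _∷_; map; foldr; replicate; _++_; _∷ʳ_; filter; concatMap; reverse; length)
  open import Data.List.Properties
    using (map-∘; map-id; length-map; unfold-reverse; reverse-involutive; reverse-map; length-reverse; reverse-injective; ∷-injectiveˡ; ∷-injectiveʳ; ≡-dec)
  open import Data.List.Membership.Propositional using (_∈_; find)
  open import Data.List.Membership.Propositional.Properties using (∈-map⁺; ∈-map⁻; ∈-filter⁺; ∈-filter⁻; ∈-concatMap⁺; ∈-concatMap⁻)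
  open import Data.List.Membership.Propositional.Properties.WithK using (unique∧set⇒bag)
  open import Data.List.Relation.Unary.Any as Any using (here; there)
  open import Data.List.Relation.Unary.All using (All; []; _∷_; universal)
  import Data.List.Relation.Unary.All.Properties as All
  open import Data.List.Relation.Unary.Unique.Propositional using (Unique; []; _∷_)
  open import Data.List.Relation.Unary.Unique.Propositional.Properties using (map⁺; filter⁺)
  open import Data.List.Relation.Binary.BagAndSetEquality using (∼bag⇒↭)
  open import Data.List.Relation.Binary.Permutation.Propositional using (_↭_)
  import Data.List.Relation.Binary.Permutation.Propositional.Properties as Permutation
  open import Data.List.Relation.Binary.Pointwise as Pointwise using (Pointwise; []; _∷_; Pointwise-≡⇒≡)
  open import Data.Product using (∃; _×_; _,_; proj₁; proj₂)
  open import Data.Sum using (_⊎_; inj₁; inj₂)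
  open import Data.Empty using (⊥; ⊥-elim)
  open import Function using (_∘_; mk⇔)
  open import Relation.Binary.Definitions using (DecidableEquality)
  open import Relation.Nullary using (Dec; yes; no)
  open import Relation.Binary.PropositionalEquality

  module _ {X : Set} where

    sum-map-cong : ∀ {f g : X → ℕ} xs → (∀ {x} → x ∈ xs → f x ≡ g x) → sum (map f xs) ≡ sum (map g xs)
    sum-map-cong []       f≡g = refl
    sum-map-cong (x ∷ xs) f≡g = cong₂ _+_ (f≡g (here refl)) (sum-map-cong xs (f≡g ∘ there))

    sum-map-+ : ∀ (f g : X → ℕ) xs → sum (map (λ x → f x + g x) xs) ≡ sum (map f xs) + sum (map g xs)
    sum-map-+ f g []       = refl
    sum-map-+ f g (x ∷ xs) = trans (cong (f x + g x +_) (sum-map-+ f g xs)) (interchange (f x) (g x) _ _)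

    sum-map-*ˡ : ∀ c (f : X → ℕ) xs → sum (map (λ x → c * f x) xs) ≡ c * sum (map f xs)
    sum-map-*ˡ c f []       = sym (*-zeroʳ c)
    sum-map-*ˡ c f (x ∷ xs) = trans (cong (c * f x +_) (sum-map-*ˡ c f xs)) (sym (*-distribˡ-+ c (f x) _))

    sum-map-∘ : ∀ {Y : Set} (f : Y → ℕ) (g : X → Y) xs → sum (map f (map g xs)) ≡ sum (map (f ∘ g) xs)
    sum-map-∘ f g xs = cong sum (sym (map-∘ xs))

    sum-map-filter : ∀ (P : X → Bool) (f : X → ℕ) xs →
      sum (map f (filter (λ x → Data.Bool._≟_ (P x) true) xs)) ≡ sum (map (λ x → boolToℕ (P x) * f x) xs)
    sum-map-filter P f []       = refl
    sum-map-filter P f (x ∷ xs) with P x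
    ... | true  = cong₂ _+_ (sym (+-identityʳ (f x))) (sum-map-filter P f xs)
    ... | false = sum-map-filter P f xs

  -- Falling factorials and generating polynomials

  infixl 8 _↓_

  _↓_ : ℕ → ℕ → ℕ
  m     ↓ zero  = 1
  zero  ↓ suc j = 0
  suc m ↓ suc j = suc m * (m ↓ j)

  ↓-one : ∀ m → m ↓ 1 ≡ m
  ↓-one zero    = refl
  ↓-one (suc m) = *-identityʳ (suc m)

  -- m ↓ (j + 1) = (m − j) · (m ↓ j), with the subtraction moved to the left.
  ↓-suc : ∀ m j → m ↓ suc j + j * (m ↓ j) ≡ m * (m ↓ j)
  ↓-suc zero    zero    = refl
  ↓-suc zero    (suc j) = *-zeroʳ j
  ↓-suc (suc m) zero    = +-identityʳ _
  ↓-suc (suc m) (suc j) = begin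
    suc m * (m ↓ suc j) + suc j * (suc m * (m ↓ j))   ≡⟨ factor m j (m ↓ suc j) (m ↓ j) ⟩
    suc m * (m ↓ suc j + j * (m ↓ j)) + suc m * (m ↓ j) ≡⟨ cong (λ x → suc m * x + suc m * (m ↓ j)) (↓-suc m j) ⟩
    suc m * (m * (m ↓ j)) + suc m * (m ↓ j)           ≡⟨ collect m (m ↓ j) ⟩
    suc m * (suc m * (m ↓ j))                         ∎
    where
    open ≡-Reasoning
    factor : ∀ m j x y → suc m * x + suc j * (suc m * y) ≡ suc m * (x + j * y) + suc m * y
    factor = solve-∀
    collect : ∀ m y → suc m * (m * y) + suc m * y ≡ suc m * (suc m * y)
    collect = solve-∀

  ↓-pascal : ∀ m j → suc m ↓ suc j ≡ m ↓ suc j + suc j * (m ↓ j)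
  ↓-pascal m j = begin
    suc m * (m ↓ j)                 ≡⟨ +-comm (m ↓ j) (m * (m ↓ j)) ⟩
    m * (m ↓ j) + m ↓ j             ≡⟨ cong (_+ m ↓ j) (sym (↓-suc m j)) ⟩
    m ↓ suc j + j * (m ↓ j) + m ↓ j ≡⟨ collect (m ↓ suc j) j (m ↓ j) ⟩
    m ↓ suc j + suc j * (m ↓ j)     ∎
    where
    open ≡-Reasoning
    collect : ∀ x j y → x + j * y + y ≡ x + suc j * y
    collect = solve-∀

  ↓2-suc : ∀ m → suc m ↓ 2 ≡ m ↓ 2 + 2 * m
  ↓2-suc m = trans (↓-pascal m 1) (cong (λ x → m ↓ 2 + 2 * x) (↓-one m))

  deriv^ : ℕ → Poly → Poly
  deriv^ zero    p = p
  deriv^ (suc j) p = deriv^ j (deriv p)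

  scaledMono : ℕ → ℕ → Poly
  scaledMono c m = replicate m 0 ++ (c ∷ [])

  addP-identityʳ : ∀ p → addP p [] ≡ p
  addP-identityʳ []      = refl
  addP-identityʳ (a ∷ p) = refl

  eval1-addP : ∀ p q → eval1 (addP p q) ≡ eval1 p + eval1 q
  eval1-addP []      q       = refl
  eval1-addP (a ∷ p) []      = sym (+-identityʳ _)
  eval1-addP (a ∷ p) (b ∷ q) = trans (cong (a + b +_) (eval1-addP p q)) (interchange a b (sum p) (sum q))

  derivFrom-addP : ∀ k p q → derivFrom k (addP p q) ≡ addP (derivFrom k p) (derivFrom k q)
  derivFrom-addP k []      q       = refl
  derivFrom-addP k (a ∷ p) []      = refl
  derivFrom-addP k (a ∷ p) (b ∷ q) = cong₂ _∷_ (*-distribˡ-+ k a b) (derivFrom-addP (suc k) p q)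

  deriv-addP : ∀ p q → deriv (addP p q) ≡ addP (deriv p) (deriv q)
  deriv-addP []      q       = refl
  deriv-addP (a ∷ p) []      = sym (addP-identityʳ _)
  deriv-addP (a ∷ p) (b ∷ q) = derivFrom-addP 1 p q

  deriv^-addP : ∀ j p q → deriv^ j (addP p q) ≡ addP (deriv^ j p) (deriv^ j q)
  deriv^-addP zero    p q = refl
  deriv^-addP (suc j) p q = trans (cong (deriv^ j) (deriv-addP p q)) (deriv^-addP j (deriv p) (deriv q))

  deriv^-[] : ∀ j → deriv^ j [] ≡ []
  deriv^-[] zero    = refl
  deriv^-[] (suc j) = deriv^-[] j

  eval1-scaledMono : ∀ c m → eval1 (scaledMono c m) ≡ c
  eval1-scaledMono c zero    = +-identityʳ c
  eval1-scaledMono c (suc m) = eval1-scaledMono c m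

  derivFrom-scaledMono : ∀ k c m → derivFrom k (scaledMono c m) ≡ scaledMono ((k + m) * c) m
  derivFrom-scaledMono k c zero    = cong (λ i → i * c ∷ []) (sym (+-identityʳ k))
  derivFrom-scaledMono k c (suc m) = cong₂ _∷_ (*-zeroʳ k)
    (trans (derivFrom-scaledMono (suc k) c m) (cong (λ i → scaledMono (i * c) m) (sym (+-suc k m))))

  eval1-deriv^-scaledMono : ∀ j c m → eval1 (deriv^ j (scaledMono c m)) ≡ m ↓ j * c
  eval1-deriv^-scaledMono zero    c m       = trans (eval1-scaledMono c m) (sym (+-identityʳ c))
  eval1-deriv^-scaledMono (suc j) c zero    = cong eval1 (deriv^-[] j)
  eval1-deriv^-scaledMono (suc j) c (suc m) = begin
    eval1 (deriv^ j (derivFrom 1 (scaledMono c m))) ≡⟨ cong (eval1 ∘ deriv^ j) (derivFrom-scaledMono 1 c m) ⟩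
    eval1 (deriv^ j (scaledMono (suc m * c) m))     ≡⟨ eval1-deriv^-scaledMono j (suc m * c) m ⟩
    m ↓ j * (suc m * c)                              ≡⟨ reassociate (m ↓ j) (suc m) c ⟩
    suc m * (m ↓ j) * c                              ∎
    where
    open ≡-Reasoning
    reassociate : ∀ x y c → x * (y * c) ≡ y * x * c
    reassociate = solve-∀

  eval1-deriv^-mono : ∀ j m → eval1 (deriv^ j (mono m)) ≡ m ↓ j
  eval1-deriv^-mono j m = trans (eval1-deriv^-scaledMono j 1 m) (*-identityʳ (m ↓ j))

  module _ {X : Set} where

    genPolyOf : (X → ℕ) → List X → Poly
    genPolyOf f = foldr (λ x acc → addP (mono (f x)) acc) []

    additive-genPolyOf : (E : Poly → ℕ) → E [] ≡ 0 → (∀ p q → E (addP p q) ≡ E p + E q) →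
      ∀ f xs → E (genPolyOf f xs) ≡ sum (map (E ∘ mono ∘ f) xs)
    additive-genPolyOf E E[] E-addP f []       = E[]
    additive-genPolyOf E E[] E-addP f (x ∷ xs) =
      trans (E-addP (mono (f x)) _) (cong (E (mono (f x)) +_) (additive-genPolyOf E E[] E-addP f xs))

    eval1-deriv^-genPolyOf : ∀ j f xs → eval1 (deriv^ j (genPolyOf f xs)) ≡ sum (map (λ x → f x ↓ j) xs)
    eval1-deriv^-genPolyOf j f xs = begin
      eval1 (deriv^ j (genPolyOf f xs))               ≡⟨ additive-genPolyOf (eval1 ∘ deriv^ j) (cong eval1 (deriv^-[] j)) E-addP f xs ⟩
      sum (map (λ x → eval1 (deriv^ j (mono (f x)))) xs) ≡⟨ sum-map-cong xs (λ {x} _ → eval1-deriv^-mono j (f x)) ⟩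
      sum (map (λ x → f x ↓ j) xs)                    ∎
      where
      open ≡-Reasoning
      E-addP : ∀ p q → eval1 (deriv^ j (addP p q)) ≡ eval1 (deriv^ j p) + eval1 (deriv^ j q)
      E-addP p q = trans (cong eval1 (deriv^-addP j p q)) (eval1-addP (deriv^ j p) (deriv^ j q))

    eval1-deriv-genPolyOf : ∀ f xs → eval1 (deriv (genPolyOf f xs)) ≡ sum (map f xs)
    eval1-deriv-genPolyOf f xs = trans (eval1-deriv^-genPolyOf 1 f xs) (sum-map-cong xs (λ {x} _ → ↓-one (f x)))

  monoY : ℕ → Poly → Poly2
  monoY a p = replicate a [] ++ (p ∷ [])

  addP2-identityʳ : ∀ p → addP2 p [] ≡ p
  addP2-identityʳ []      = refl
  addP2-identityʳ (a ∷ p) = refl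

  eval11-addP2 : ∀ p q → eval11 (addP2 p q) ≡ eval11 p + eval11 q
  eval11-addP2 []      q       = refl
  eval11-addP2 (a ∷ p) []      = sym (+-identityʳ _)
  eval11-addP2 (a ∷ p) (b ∷ q) =
    trans (cong₂ _+_ (eval1-addP a b) (eval11-addP2 p q)) (interchange (sum a) (sum b) (eval11 p) (eval11 q))

  derivQ-addP2 : ∀ p q → derivQ (addP2 p q) ≡ addP2 (derivQ p) (derivQ q)
  derivQ-addP2 []      q       = refl
  derivQ-addP2 (a ∷ p) []      = refl
  derivQ-addP2 (a ∷ p) (b ∷ q) = cong₂ _∷_ (deriv-addP a b) (derivQ-addP2 p q)

  map-*-addP : ∀ k p q → map (k *_) (addP p q) ≡ addP (map (k *_) p) (map (k *_) q)
  map-*-addP k []      q       = refl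
  map-*-addP k (a ∷ p) []      = refl
  map-*-addP k (a ∷ p) (b ∷ q) = cong₂ _∷_ (*-distribˡ-+ k a b) (map-*-addP k p q)

  derivFromY-addP2 : ∀ k p q → derivFromY k (addP2 p q) ≡ addP2 (derivFromY k p) (derivFromY k q)
  derivFromY-addP2 k []      q       = refl
  derivFromY-addP2 k (a ∷ p) []      = refl
  derivFromY-addP2 k (a ∷ p) (b ∷ q) = cong₂ _∷_ (map-*-addP k a b) (derivFromY-addP2 (suc k) p q)

  derivY-addP2 : ∀ p q → derivY (addP2 p q) ≡ addP2 (derivY p) (derivY q)
  derivY-addP2 []      q       = refl
  derivY-addP2 (a ∷ p) []      = sym (addP2-identityʳ _)
  derivY-addP2 (a ∷ p) (b ∷ q) = derivFromY-addP2 1 p q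

  eval11-monoY : ∀ a p → eval11 (monoY a p) ≡ eval1 p
  eval11-monoY zero    p = +-identityʳ _
  eval11-monoY (suc a) p = eval11-monoY a p

  derivQ-monoY : ∀ a p → derivQ (monoY a p) ≡ monoY a (deriv p)
  derivQ-monoY zero    p = refl
  derivQ-monoY (suc a) p = cong ([] ∷_) (derivQ-monoY a p)

  derivFromY-monoY : ∀ k a p → derivFromY k (monoY a p) ≡ monoY a (map ((k + a) *_) p)
  derivFromY-monoY k zero    p = cong (λ i → map (i *_) p ∷ []) (sym (+-identityʳ k))
  derivFromY-monoY k (suc a) p = cong ([] ∷_)
    (trans (derivFromY-monoY (suc k) a p) (cong (λ i → monoY a (map (i *_) p)) (sym (+-suc k a))))

  eval11-derivY-monoY : ∀ a p → eval11 (derivY (monoY a p)) ≡ a * eval1 p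
  eval11-derivY-monoY zero    p = refl
  eval11-derivY-monoY (suc a) p = begin
    eval11 (derivFromY 1 (monoY a p))  ≡⟨ cong eval11 (derivFromY-monoY 1 a p) ⟩
    eval11 (monoY a (map (suc a *_) p)) ≡⟨ eval11-monoY a _ ⟩
    sum (map (suc a *_) p)              ≡⟨ sum-map-*ˡ (suc a) (λ x → x) p ⟩
    suc a * sum (map (λ x → x) p)       ≡⟨ cong (λ q → suc a * sum q) (map-id p) ⟩
    suc a * eval1 p                     ∎
    where open ≡-Reasoning

  module _ {X : Set} where

    genPoly2Of : (X → ℕ) → (X → ℕ) → List X → Poly2
    genPoly2Of g f = foldr (λ x acc → addP2 (mono2 (g x) (f x)) acc) []

    additive-genPoly2Of : (E : Poly2 → ℕ) → E [] ≡ 0 → (∀ p q → E (addP2 p q) ≡ E p + E q) →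
      ∀ g f xs → E (genPoly2Of g f xs) ≡ sum (map (λ x → E (mono2 (g x) (f x))) xs)
    additive-genPoly2Of E E[] E-addP2 g f []       = E[]
    additive-genPoly2Of E E[] E-addP2 g f (x ∷ xs) =
      trans (E-addP2 (mono2 (g x) (f x)) _) (cong (E (mono2 (g x) (f x)) +_) (additive-genPoly2Of E E[] E-addP2 g f xs))

    eval11-derivQ-genPoly2Of : ∀ g f xs → eval11 (derivQ (genPoly2Of g f xs)) ≡ sum (map f xs)
    eval11-derivQ-genPoly2Of g f xs = begin
      eval11 (derivQ (genPoly2Of g f xs))                       ≡⟨ additive-genPoly2Of (eval11 ∘ derivQ) refl E-addP2 g f xs ⟩
      sum (map (λ x → eval11 (derivQ (mono2 (g x) (f x)))) xs) ≡⟨ sum-map-cong xs (λ {x} _ → monomial (g x) (f x)) ⟩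
      sum (map f xs)                                            ∎
      where
      open ≡-Reasoning
      E-addP2 : ∀ p q → eval11 (derivQ (addP2 p q)) ≡ eval11 (derivQ p) + eval11 (derivQ q)
      E-addP2 p q = trans (cong eval11 (derivQ-addP2 p q)) (eval11-addP2 (derivQ p) (derivQ q))
      monomial : ∀ a b → eval11 (derivQ (mono2 a b)) ≡ b
      monomial a b = trans (cong eval11 (derivQ-monoY a (mono b)))
        (trans (eval11-monoY a _) (trans (eval1-deriv^-mono 1 b) (↓-one b)))

    eval11-derivY-derivQ-genPoly2Of : ∀ g f xs → eval11 (derivY (derivQ (genPoly2Of g f xs))) ≡ sum (map (λ x → g x * f x) xs)
    eval11-derivY-derivQ-genPoly2Of g f xs = begin
      eval11 (derivY (derivQ (genPoly2Of g f xs)))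
        ≡⟨ additive-genPoly2Of (eval11 ∘ derivY ∘ derivQ) refl E-addP2 g f xs ⟩
      sum (map (λ x → eval11 (derivY (derivQ (mono2 (g x) (f x))))) xs)
        ≡⟨ sum-map-cong xs (λ {x} _ → monomial (g x) (f x)) ⟩
      sum (map (λ x → g x * f x) xs) ∎
      where
      open ≡-Reasoning
      E-addP2 : ∀ p q → eval11 (derivY (derivQ (addP2 p q))) ≡ eval11 (derivY (derivQ p)) + eval11 (derivY (derivQ q))
      E-addP2 p q = trans (cong (eval11 ∘ derivY) (derivQ-addP2 p q))
        (trans (cong eval11 (derivY-addP2 (derivQ p) (derivQ q))) (eval11-addP2 (derivY (derivQ p)) (derivY (derivQ q))))
      monomial : ∀ a b → eval11 (derivY (derivQ (mono2 a b))) ≡ a * b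
      monomial a b = trans (cong (eval11 ∘ derivY) (derivQ-monoY a (mono b)))
        (trans (eval11-derivY-monoY a _) (cong (a *_) (trans (eval1-deriv^-mono 1 b) (↓-one b))))

  -- The enumeration of 𝒟ₙ

  pairOf : Word → List Word
  pairOf w = (u ∷ w) ∷ (d ∷ w) ∷ []

  sum-words-suc : ∀ m (h : Word → ℕ) → sum (map h (words (suc m))) ≡ sum (map (λ w → h (u ∷ w) + h (d ∷ w)) (words m))
  sum-words-suc m h = sum-concatMap-pairOf (words m)
    where
    sum-concatMap-pairOf : ∀ ws → sum (map h (concatMap pairOf ws)) ≡ sum (map (λ w → h (u ∷ w) + h (d ∷ w)) ws)
    sum-concatMap-pairOf []       = refl
    sum-concatMap-pairOf (w ∷ ws) =
      trans (cong (λ x → h (u ∷ w) + (h (d ∷ w) + x)) (sum-concatMap-pairOf ws)) (sym (+-assoc (h (u ∷ w)) _ _))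

  ∈-words : ∀ w → w ∈ words (length w)
  ∈-words []      = here refl
  ∈-words (s ∷ w) = ∈-concatMap⁺ pairOf (Any.map (λ { refl → ∷-∈-pairOf s }) (∈-words w))
    where
    ∷-∈-pairOf : ∀ s → s ∷ w ∈ pairOf w
    ∷-∈-pairOf u = here refl
    ∷-∈-pairOf d = there (here refl)

  words-length : ∀ m {w} → w ∈ words m → length w ≡ m
  words-length zero    (here refl) = refl
  words-length (suc m) w∈ with find (∈-concatMap⁻ pairOf {xs = words m} w∈)
  ... | x , x∈ , here refl         = cong suc (words-length m x∈)
  ... | x , x∈ , there (here refl) = cong suc (words-length m x∈)

  words-unique : ∀ m → Unique (words m)
  words-unique zero    = [] ∷ []
  words-unique (suc m) = concatMap-pairOf-unique (words-unique m)
    where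
    ∷-avoids : ∀ {w ws} s → All (w ≢_) ws → All ((s ∷ w) ≢_) (concatMap pairOf ws)
    ∷-avoids s []           = []
    ∷-avoids s (w≢x ∷ w≢xs) = (w≢x ∘ ∷-injectiveʳ) ∷ (w≢x ∘ ∷-injectiveʳ) ∷ ∷-avoids s w≢xs
    concatMap-pairOf-unique : ∀ {ws} → Unique ws → Unique (concatMap pairOf ws)
    concatMap-pairOf-unique []             = []
    concatMap-pairOf-unique (w∉ws ∷ uniq) =
      ((λ ()) ∷ ∷-avoids u w∉ws) ∷ ∷-avoids d w∉ws ∷ concatMap-pairOf-unique uniq

  IsDyck : ℕ → Word → Set
  IsDyck n w = isDyck w ≡ true × length w ≡ n + n

  ∈-dyck⁺ : ∀ n {w} → IsDyck n w → w ∈ dyck n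
  ∈-dyck⁺ n {w} (dy , len) = ∈-filter⁺ (λ w → Data.Bool._≟_ (isDyck w) true) (subst (λ m → w ∈ words m) len (∈-words w)) dy

  ∈-dyck⁻ : ∀ n {w} → w ∈ dyck n → IsDyck n w
  ∈-dyck⁻ n w∈ with ∈-filter⁻ (λ w → Data.Bool._≟_ (isDyck w) true) {xs = words (n + n)} w∈
  ... | w∈words , dy = dy , words-length (n + n) w∈words

  dyck-unique : ∀ n → Unique (dyck n)
  dyck-unique n = filter⁺ (λ w → Data.Bool._≟_ (isDyck w) true) (words-unique (n + n))

  sumDyck : ℕ → (Word → ℕ) → ℕ
  sumDyck n f = sum (map f (dyck n))

  -- Mirror symmetry

  opposite : Step → Step
  opposite u = d
  opposite d = u

  mirror : Word → Word
  mirror w = reverse (map opposite w)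

  mirror-∷ : ∀ s w → mirror (s ∷ w) ≡ mirror w ∷ʳ opposite s
  mirror-∷ s w = unfold-reverse (opposite s) (map opposite w)

  sum-words-∷ʳ : ∀ m (h : Word → ℕ) → sum (map h (words (suc m))) ≡ sum (map (λ w → h (w ∷ʳ u) + h (w ∷ʳ d)) (words m))
  sum-words-∷ʳ zero    h = sym (+-assoc (h (u ∷ [])) (h (d ∷ [])) 0)
  sum-words-∷ʳ (suc m) h = begin
    sum (map h (words (suc (suc m))))                                                  ≡⟨ sum-words-suc (suc m) h ⟩
    sum (map (λ w → h (u ∷ w) + h (d ∷ w)) (words (suc m)))                            ≡⟨ sum-words-∷ʳ m _ ⟩
    sum (map (λ w → h (u ∷ w ∷ʳ u) + h (d ∷ w ∷ʳ u) + (h (u ∷ w ∷ʳ d) + h (d ∷ w ∷ʳ d))) (words m))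
      ≡⟨ sum-map-cong (words m) (λ {w} _ → interchange (h (u ∷ w ∷ʳ u)) (h (d ∷ w ∷ʳ u)) (h (u ∷ w ∷ʳ d)) (h (d ∷ w ∷ʳ d))) ⟩
    sum (map (λ w → h (u ∷ w ∷ʳ u) + h (u ∷ w ∷ʳ d) + (h (d ∷ w ∷ʳ u) + h (d ∷ w ∷ʳ d))) (words m))
      ≡⟨ sym (sum-words-suc m _) ⟩
    sum (map (λ w → h (w ∷ʳ u) + h (w ∷ʳ d)) (words (suc m)))                          ∎
    where open ≡-Reasoning

  sum-words-mirror : ∀ m (h : Word → ℕ) → sum (map (h ∘ mirror) (words m)) ≡ sum (map h (words m))
  sum-words-mirror zero    h = refl
  sum-words-mirror (suc m) h = begin
    sum (map (h ∘ mirror) (words (suc m)))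
      ≡⟨ sum-words-suc m (h ∘ mirror) ⟩
    sum (map (λ w → h (mirror (u ∷ w)) + h (mirror (d ∷ w))) (words m))
      ≡⟨ sum-map-cong (words m) (λ {w} _ → cong₂ _+_ (cong h (mirror-∷ u w)) (cong h (mirror-∷ d w))) ⟩
    sum (map (λ w → h (mirror w ∷ʳ d) + h (mirror w ∷ʳ u)) (words m))
      ≡⟨ sum-words-mirror m (λ w → h (w ∷ʳ d) + h (w ∷ʳ u)) ⟩
    sum (map (λ w → h (w ∷ʳ d) + h (w ∷ʳ u)) (words m))
      ≡⟨ sum-map-cong (words m) (λ {w} _ → +-comm (h (w ∷ʳ d)) (h (w ∷ʳ u))) ⟩
    sum (map (λ w → h (w ∷ʳ u) + h (w ∷ʳ d)) (words m))
      ≡⟨ sym (sum-words-∷ʳ m h) ⟩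
    sum (map h (words (suc m))) ∎
    where open ≡-Reasoning

  pathFromTo : ℕ → Word → ℕ → Bool
  pathFromTo h       []      e = h ≡ᵇ e
  pathFromTo h       (u ∷ w) e = pathFromTo (suc h) w e
  pathFromTo zero    (d ∷ w) e = false
  pathFromTo (suc h) (d ∷ w) e = pathFromTo h w e

  dyckFrom≡pathFromTo : ∀ h w → dyckFrom h w ≡ pathFromTo h w 0
  dyckFrom≡pathFromTo zero    []      = refl
  dyckFrom≡pathFromTo (suc h) []      = refl
  dyckFrom≡pathFromTo zero    (u ∷ w) = dyckFrom≡pathFromTo 1 w
  dyckFrom≡pathFromTo (suc h) (u ∷ w) = dyckFrom≡pathFromTo (suc (suc h)) w
  dyckFrom≡pathFromTo zero    (d ∷ w) = refl
  dyckFrom≡pathFromTo (suc h) (d ∷ w) = dyckFrom≡pathFromTo h w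

  pathFromTo-∷ʳd : ∀ h w e → pathFromTo h (w ∷ʳ d) e ≡ pathFromTo h w (suc e)
  pathFromTo-∷ʳd zero    []      e = refl
  pathFromTo-∷ʳd (suc h) []      e = refl
  pathFromTo-∷ʳd h       (u ∷ w) e = pathFromTo-∷ʳd (suc h) w e
  pathFromTo-∷ʳd zero    (d ∷ w) e = refl
  pathFromTo-∷ʳd (suc h) (d ∷ w) e = pathFromTo-∷ʳd h w e

  pathFromTo-∷ʳu-zero : ∀ h w → pathFromTo h (w ∷ʳ u) zero ≡ false
  pathFromTo-∷ʳu-zero h       []      = refl
  pathFromTo-∷ʳu-zero h       (u ∷ w) = pathFromTo-∷ʳu-zero (suc h) w
  pathFromTo-∷ʳu-zero zero    (d ∷ w) = refl
  pathFromTo-∷ʳu-zero (suc h) (d ∷ w) = pathFromTo-∷ʳu-zero h w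

  pathFromTo-∷ʳu-suc : ∀ h w e → pathFromTo h (w ∷ʳ u) (suc e) ≡ pathFromTo h w e
  pathFromTo-∷ʳu-suc h       []      e = refl
  pathFromTo-∷ʳu-suc h       (u ∷ w) e = pathFromTo-∷ʳu-suc (suc h) w e
  pathFromTo-∷ʳu-suc zero    (d ∷ w) e = refl
  pathFromTo-∷ʳu-suc (suc h) (d ∷ w) e = pathFromTo-∷ʳu-suc h w e

  ≡ᵇ-sym : ∀ m n → (m ≡ᵇ n) ≡ (n ≡ᵇ m)
  ≡ᵇ-sym zero    zero    = refl
  ≡ᵇ-sym zero    (suc n) = refl
  ≡ᵇ-sym (suc m) zero    = refl
  ≡ᵇ-sym (suc m) (suc n) = ≡ᵇ-sym m n

  pathFromTo-mirror : ∀ h w e → pathFromTo h (mirror w) e ≡ pathFromTo e w h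
  pathFromTo-mirror h []      e       = ≡ᵇ-sym h e
  pathFromTo-mirror h (u ∷ w) e       = begin
    pathFromTo h (mirror (u ∷ w)) e    ≡⟨ cong (λ v → pathFromTo h v e) (mirror-∷ u w) ⟩
    pathFromTo h (mirror w ∷ʳ d) e     ≡⟨ pathFromTo-∷ʳd h (mirror w) e ⟩
    pathFromTo h (mirror w) (suc e)    ≡⟨ pathFromTo-mirror h w (suc e) ⟩
    pathFromTo (suc e) w h             ∎
    where open ≡-Reasoning
  pathFromTo-mirror h (d ∷ w) zero    = trans (cong (λ v → pathFromTo h v 0) (mirror-∷ d w)) (pathFromTo-∷ʳu-zero h (mirror w))
  pathFromTo-mirror h (d ∷ w) (suc e) = begin
    pathFromTo h (mirror (d ∷ w)) (suc e) ≡⟨ cong (λ v → pathFromTo h v (suc e)) (mirror-∷ d w) ⟩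
    pathFromTo h (mirror w ∷ʳ u) (suc e)  ≡⟨ pathFromTo-∷ʳu-suc h (mirror w) e ⟩
    pathFromTo h (mirror w) e             ≡⟨ pathFromTo-mirror h w e ⟩
    pathFromTo e w h                      ∎
    where open ≡-Reasoning

  isDyck-mirror : ∀ w → isDyck (mirror w) ≡ isDyck w
  isDyck-mirror w = begin
    dyckFrom 0 (mirror w)   ≡⟨ dyckFrom≡pathFromTo 0 (mirror w) ⟩
    pathFromTo 0 (mirror w) 0 ≡⟨ pathFromTo-mirror 0 w 0 ⟩
    pathFromTo 0 w 0        ≡⟨ sym (dyckFrom≡pathFromTo 0 w) ⟩
    dyckFrom 0 w            ∎
    where open ≡-Reasoning

  sum-dyck-mirror : ∀ n (f : Word → ℕ) → sumDyck n (f ∘ mirror) ≡ sumDyck n f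
  sum-dyck-mirror n f = begin
    sum (map (f ∘ mirror) (dyck n))
      ≡⟨ sum-map-filter isDyck (f ∘ mirror) (words (n + n)) ⟩
    sum (map (λ w → boolToℕ (isDyck w) * f (mirror w)) (words (n + n)))
      ≡⟨ sum-map-cong (words (n + n)) (λ {w} _ → cong (λ b → boolToℕ b * f (mirror w)) (sym (isDyck-mirror w))) ⟩
    sum (map (λ w → boolToℕ (isDyck (mirror w)) * f (mirror w)) (words (n + n)))
      ≡⟨ sum-words-mirror (n + n) (λ w → boolToℕ (isDyck w) * f w) ⟩
    sum (map (λ w → boolToℕ (isDyck w) * f w) (words (n + n)))
      ≡⟨ sym (sum-map-filter isDyck f (words (n + n))) ⟩
    sum (map f (dyck n)) ∎
    where open ≡-Reasoning

  endsWith : Word → Word → Bool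
  endsWith p w = isPrefix (reverse p) (reverse w)

  eqW⇒≡ : ∀ p a → eqW p a ≡ true → p ≡ a
  eqW⇒≡ []      []      _ = refl
  eqW⇒≡ (u ∷ p) (u ∷ a) e = cong (u ∷_) (eqW⇒≡ p a e)
  eqW⇒≡ (d ∷ p) (d ∷ a) e = cong (d ∷_) (eqW⇒≡ p a e)

  eqW-refl : ∀ a → eqW a a ≡ true
  eqW-refl []      = refl
  eqW-refl (u ∷ a) = eqW-refl a
  eqW-refl (d ∷ a) = eqW-refl a

  eqW-reverse : ∀ p a → eqW (reverse p) (reverse a) ≡ eqW p a
  eqW-reverse p a with eqW p a in e₁ | eqW (reverse p) (reverse a) in e₂
  ... | true  | true  = refl
  ... | false | false = refl
  ... | true  | false = trans (sym e₂) (subst (λ x → eqW (reverse x) (reverse a) ≡ true) (sym (eqW⇒≡ p a e₁)) (eqW-refl (reverse a)))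
  ... | false | true  = trans (sym (eqW-refl p)) (trans (cong (eqW p) (reverse-injective (eqW⇒≡ _ _ e₂))) e₁)

  isPrefix-++ : ∀ p a b → length p ≤ length a → isPrefix p (a ++ b) ≡ isPrefix p a
  isPrefix-++ []      a       b _         = refl
  isPrefix-++ (x ∷ p) (y ∷ a) b (s≤s p≤a) = cong ((x ==S y) ∧_) (isPrefix-++ p a b p≤a)

  isPrefix-short : ∀ p a → length a < length p → isPrefix p a ≡ false
  isPrefix-short (x ∷ p) []      _         = refl
  isPrefix-short (x ∷ p) (y ∷ a) (s≤s a<p) = trans (cong ((x ==S y) ∧_) (isPrefix-short p a a<p)) (∧-zeroʳ (x ==S y))

  isPrefix-sameLength : ∀ p a → length p ≡ length a → isPrefix p a ≡ eqW p a
  isPrefix-sameLength []      []      _ = refl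
  isPrefix-sameLength (x ∷ p) (y ∷ a) e = cong ((x ==S y) ∧_) (isPrefix-sameLength p a (suc-injective e))

  endsWith-short : ∀ p w → length w < length p → endsWith p w ≡ false
  endsWith-short p w w<p = isPrefix-short (reverse p) (reverse w) (subst₂ _<_ (sym (length-reverse w)) (sym (length-reverse p)) w<p)

  length-∷ʳ : ∀ (w : Word) y → length (w ∷ʳ y) ≡ suc (length w)
  length-∷ʳ []      y = refl
  length-∷ʳ (x ∷ w) y = cong suc (length-∷ʳ w y)

  endsWith-∷ : ∀ p x w → length p ≤ length w → endsWith p (x ∷ w) ≡ endsWith p w
  endsWith-∷ p x w p≤w = begin
    isPrefix (reverse p) (reverse (x ∷ w))
      ≡⟨ cong (isPrefix (reverse p)) (unfold-reverse x w) ⟩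
    isPrefix (reverse p) (reverse w ++ x ∷ [])
      ≡⟨ isPrefix-++ (reverse p) (reverse w) (x ∷ []) (subst₂ _≤_ (sym (length-reverse p)) (sym (length-reverse w)) p≤w) ⟩
    isPrefix (reverse p) (reverse w) ∎
    where open ≡-Reasoning

  isPrefix≡endsWith : ∀ p w → length w ≤ length p → isPrefix p w ≡ endsWith p w
  isPrefix≡endsWith p w w≤p with m≤n⇒m<n∨m≡n w≤p
  ... | inj₁ w<p = trans (isPrefix-short p w w<p) (sym (endsWith-short p w w<p))
  ... | inj₂ w≡p = begin
    isPrefix p w
      ≡⟨ isPrefix-sameLength p w (sym w≡p) ⟩
    eqW p w
      ≡⟨ sym (eqW-reverse p w) ⟩
    eqW (reverse p) (reverse w)
      ≡⟨ sym (isPrefix-sameLength (reverse p) (reverse w) (trans (length-reverse p) (trans (sym w≡p) (sym (length-reverse w))))) ⟩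
    endsWith p w ∎
    where open ≡-Reasoning

  -- An occurrence in x ∷ z ∷ʳ y either avoids one of the two end letters, or is the whole word.
  isPrefix-endsWith-exchange : ∀ p x z y →
    boolToℕ (isPrefix p (x ∷ z ∷ʳ y)) + boolToℕ (endsWith p (z ∷ʳ y)) ≡
    boolToℕ (isPrefix p (x ∷ z)) + boolToℕ (endsWith p (x ∷ z ∷ʳ y))
  isPrefix-endsWith-exchange p x z y with length p ≤? length (x ∷ z)
  ... | yes p≤xz = cong₂ (λ a b → boolToℕ a + boolToℕ b)
        (isPrefix-++ p (x ∷ z) (y ∷ []) p≤xz)
        (sym (endsWith-∷ p x (z ∷ʳ y) (subst (length p ≤_) (sym (length-∷ʳ z y)) p≤xz)))
  ... | no p≰xz = begin
    boolToℕ (isPrefix p (x ∷ z ∷ʳ y)) + boolToℕ (endsWith p (z ∷ʳ y))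
      ≡⟨ cong (λ b → boolToℕ (isPrefix p (x ∷ z ∷ʳ y)) + boolToℕ b) (endsWith-short p (z ∷ʳ y) (subst (_< length p) (sym (length-∷ʳ z y)) xz<p)) ⟩
    boolToℕ (isPrefix p (x ∷ z ∷ʳ y)) + 0
      ≡⟨ +-identityʳ _ ⟩
    boolToℕ (isPrefix p (x ∷ z ∷ʳ y))
      ≡⟨ cong boolToℕ (isPrefix≡endsWith p (x ∷ z ∷ʳ y) (subst (_≤ length p) (sym (cong suc (length-∷ʳ z y))) xz<p)) ⟩
    boolToℕ (endsWith p (x ∷ z ∷ʳ y))
      ≡⟨ cong (λ b → boolToℕ b + boolToℕ (endsWith p (x ∷ z ∷ʳ y))) (sym (isPrefix-short p (x ∷ z) xz<p)) ⟩
    boolToℕ (isPrefix p (x ∷ z)) + boolToℕ (endsWith p (x ∷ z ∷ʳ y)) ∎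
    where
    open ≡-Reasoning
    xz<p : length (x ∷ z) < length p
    xz<p = ≰⇒> p≰xz

  occ-∷ʳ : ∀ p w y → occ p (w ∷ʳ y) ≡ occ p w + boolToℕ (endsWith p (w ∷ʳ y))
  occ-∷ʳ []      []      y = refl
  occ-∷ʳ (a ∷ p) []      y = trans (+-identityʳ _) (cong boolToℕ (isPrefix≡endsWith (a ∷ p) (y ∷ []) (s≤s z≤n)))
  occ-∷ʳ p       (x ∷ w) y = begin
    boolToℕ (isPrefix p (x ∷ w ∷ʳ y)) + occ p (w ∷ʳ y)
      ≡⟨ cong (boolToℕ (isPrefix p (x ∷ w ∷ʳ y)) +_) (occ-∷ʳ p w y) ⟩
    boolToℕ (isPrefix p (x ∷ w ∷ʳ y)) + (occ p w + boolToℕ (endsWith p (w ∷ʳ y)))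
      ≡⟨ x+[y+z]≡y+[x+z] (boolToℕ (isPrefix p (x ∷ w ∷ʳ y))) (occ p w) (boolToℕ (endsWith p (w ∷ʳ y))) ⟩
    occ p w + (boolToℕ (isPrefix p (x ∷ w ∷ʳ y)) + boolToℕ (endsWith p (w ∷ʳ y)))
      ≡⟨ cong (occ p w +_) (isPrefix-endsWith-exchange p x w y) ⟩
    occ p w + (boolToℕ (isPrefix p (x ∷ w)) + boolToℕ (endsWith p (x ∷ w ∷ʳ y)))
      ≡⟨ sym (+-assoc (occ p w) _ _) ⟩
    occ p w + boolToℕ (isPrefix p (x ∷ w)) + boolToℕ (endsWith p (x ∷ w ∷ʳ y))
      ≡⟨ cong (_+ boolToℕ (endsWith p (x ∷ w ∷ʳ y))) (+-comm (occ p w) _) ⟩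
    occ p (x ∷ w) + boolToℕ (endsWith p (x ∷ w ∷ʳ y)) ∎
    where
    open ≡-Reasoning
    x+[y+z]≡y+[x+z] : ∀ a b c → a + (b + c) ≡ b + (a + c)
    x+[y+z]≡y+[x+z] a b c = trans (sym (+-assoc a b c)) (trans (cong (_+ c) (+-comm a b)) (+-assoc b a c))

  isPrefix-map-opposite : ∀ q w → isPrefix q (map opposite w) ≡ isPrefix (map opposite q) w
  isPrefix-map-opposite []      w       = refl
  isPrefix-map-opposite (x ∷ q) []      = refl
  isPrefix-map-opposite (x ∷ q) (y ∷ w) = cong₂ _∧_ (==S-opposite x y) (isPrefix-map-opposite q w)
    where
    ==S-opposite : ∀ x y → (x ==S opposite y) ≡ (opposite x ==S y)
    ==S-opposite u u = refl
    ==S-opposite u d = refl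
    ==S-opposite d u = refl
    ==S-opposite d d = refl

  endsWith-mirror : ∀ p w → endsWith p (mirror w) ≡ isPrefix (mirror p) w
  endsWith-mirror p w = begin
    isPrefix (reverse p) (reverse (reverse (map opposite w)))  ≡⟨ cong (isPrefix (reverse p)) (reverse-involutive (map opposite w)) ⟩
    isPrefix (reverse p) (map opposite w)                      ≡⟨ isPrefix-map-opposite (reverse p) w ⟩
    isPrefix (map opposite (reverse p)) w                      ≡⟨ cong (λ q → isPrefix q w) (reverse-map opposite p) ⟩
    isPrefix (mirror p) w                                      ∎
    where open ≡-Reasoning

  occ-mirror : ∀ p w → occ p (mirror w) ≡ occ (mirror p) w
  occ-mirror p []      = refl
  occ-mirror p (x ∷ w) = begin
    occ p (mirror (x ∷ w))
      ≡⟨ cong (occ p) (mirror-∷ x w) ⟩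
    occ p (mirror w ∷ʳ opposite x)
      ≡⟨ occ-∷ʳ p (mirror w) (opposite x) ⟩
    occ p (mirror w) + boolToℕ (endsWith p (mirror w ∷ʳ opposite x))
      ≡⟨ cong₂ (λ a b → a + boolToℕ (endsWith p b)) (occ-mirror p w) (sym (mirror-∷ x w)) ⟩
    occ (mirror p) w + boolToℕ (endsWith p (mirror (x ∷ w)))
      ≡⟨ cong (λ b → occ (mirror p) w + boolToℕ b) (endsWith-mirror p (x ∷ w)) ⟩
    occ (mirror p) w + boolToℕ (isPrefix (mirror p) (x ∷ w))
      ≡⟨ +-comm (occ (mirror p) w) _ ⟩
    occ (mirror p) (x ∷ w) ∎
    where open ≡-Reasoning

  -- Valley flips and the covering relation

  data Flip : Word → Word → Set where
    valley : ∀ {w} → Flip (d ∷ u ∷ w) (u ∷ d ∷ w)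
    after  : ∀ s {a b} → Flip a b → Flip (s ∷ a) (s ∷ b)

  valleyFlips : Word → List Word
  valleyFlips []          = []
  valleyFlips (u ∷ w)     = map (u ∷_) (valleyFlips w)
  valleyFlips (d ∷ [])    = []
  valleyFlips (d ∷ u ∷ w) = (u ∷ d ∷ w) ∷ map (d ∷_) (valleyFlips (u ∷ w))
  valleyFlips (d ∷ d ∷ w) = map (d ∷_) (valleyFlips (d ∷ w))

  Flip⇒∈ : ∀ {a b} → Flip a b → b ∈ valleyFlips a
  Flip⇒∈ valley                       = here refl
  Flip⇒∈ (after u f)                  = ∈-map⁺ (u ∷_) (Flip⇒∈ f)
  Flip⇒∈ (after d {u ∷ a} f)          = there (∈-map⁺ (d ∷_) (Flip⇒∈ f))
  Flip⇒∈ (after d {d ∷ a} f)          = ∈-map⁺ (d ∷_) (Flip⇒∈ f)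

  ∈⇒Flip : ∀ a {b} → b ∈ valleyFlips a → Flip a b
  ∈⇒Flip (u ∷ a) b∈ with ∈-map⁻ (u ∷_) b∈
  ... | _ , b′∈ , refl = after u (∈⇒Flip a b′∈)
  ∈⇒Flip (d ∷ u ∷ a) (here refl) = valley
  ∈⇒Flip (d ∷ u ∷ a) (there b∈) with ∈-map⁻ (d ∷_) b∈
  ... | _ , b′∈ , refl = after d (∈⇒Flip (u ∷ a) b′∈)
  ∈⇒Flip (d ∷ d ∷ a) b∈ with ∈-map⁻ (d ∷_) b∈
  ... | _ , b′∈ , refl = after d (∈⇒Flip (d ∷ a) b′∈)

  Flip-length : ∀ {a b} → Flip a b → length b ≡ length a
  Flip-length valley      = refl
  Flip-length (after s f) = cong suc (Flip-length f)

  Flip-≢ : ∀ {a b} → Flip a b → a ≢ b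
  Flip-≢ valley      ()
  Flip-≢ (after s f) refl = Flip-≢ f refl

  dyckFrom-u : ∀ h w → dyckFrom h (u ∷ w) ≡ dyckFrom (suc h) w
  dyckFrom-u zero    w = refl
  dyckFrom-u (suc h) w = refl

  Flip-dyckFrom : ∀ h {a b} → Flip a b → dyckFrom h a ≡ true → dyckFrom h b ≡ true
  Flip-dyckFrom (suc h) {d ∷ u ∷ w} valley dy = trans (sym (dyckFrom-u h w)) dy
  Flip-dyckFrom h       (after u f)      dy = trans (dyckFrom-u h _) (Flip-dyckFrom (suc h) f (trans (sym (dyckFrom-u h _)) dy))
  Flip-dyckFrom (suc h) (after d f)      dy = Flip-dyckFrom h f dy

  infix 4 _≤[_]_

  _≤[_]_ : Word → ℕ → Word → Set
  a ≤[ h ] b = Pointwise _≤_ (heights h a) (heights h b)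

  ≤[]-refl : ∀ h a → a ≤[ h ] a
  ≤[]-refl h a = Pointwise.refl ≤-refl

  2+n≰n : ∀ {n} → suc (suc n) ≰ n
  2+n≰n {suc n} (s≤s 2+n≤n) = 2+n≰n 2+n≤n

  heights-injective : ∀ h a b → heights h a ≡ heights h b → a ≡ b
  heights-injective h       []      []      _ = refl
  heights-injective h       (u ∷ a) (u ∷ b) e = cong (u ∷_) (heights-injective (suc h) a b (∷-injectiveʳ e))
  heights-injective zero    (d ∷ a) (d ∷ b) e = cong (d ∷_) (heights-injective zero a b (∷-injectiveʳ e))
  heights-injective (suc h) (d ∷ a) (d ∷ b) e = cong (d ∷_) (heights-injective h a b (∷-injectiveʳ e))
  heights-injective (suc h) (u ∷ a) (d ∷ b) e = ⊥-elim (2+n≰n (≤-reflexive (∷-injectiveˡ e)))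
  heights-injective (suc h) (d ∷ a) (u ∷ b) e = ⊥-elim (2+n≰n (≤-reflexive (sym (∷-injectiveˡ e))))
  heights-injective zero    (u ∷ a) (d ∷ b) ()
  heights-injective zero    (d ∷ a) (u ∷ b) ()
  heights-injective h       []      (u ∷ b) ()
  heights-injective zero    []      (d ∷ b) ()
  heights-injective (suc h) []      (d ∷ b) ()
  heights-injective h       (u ∷ a) []      ()
  heights-injective zero    (d ∷ a) []      ()
  heights-injective (suc h) (d ∷ a) []      ()

  ≤[]-antisym : ∀ {h a b} → a ≤[ h ] b → b ≤[ h ] a → a ≡ b
  ≤[]-antisym {h} {a} {b} a≤b b≤a = heights-injective h a b (Pointwise-≡⇒≡ (Pointwise.antisymmetric ≤-antisym a≤b b≤a))

  Flip-≤ : ∀ h {a b} → dyckFrom h a ≡ true → Flip a b → a ≤[ h ] b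
  Flip-≤ (suc h) {d ∷ u ∷ w} dy valley = ≤-trans (n≤1+n h) (n≤1+n (suc h)) ∷ ≤-refl ∷ ≤[]-refl (suc h) w
  Flip-≤ h       dy (after u f) = ≤-refl ∷ Flip-≤ (suc h) (trans (sym (dyckFrom-u h _)) dy) f
  Flip-≤ (suc h) dy (after d f) = ≤-refl ∷ Flip-≤ h dy f

  Flip-squeeze : ∀ h {a b} δ → dyckFrom h a ≡ true → Flip a b → a ≤[ h ] δ → δ ≤[ h ] b → δ ≡ a ⊎ δ ≡ b
  Flip-squeeze h       (u ∷ δ) dy (after u f) (_ ∷ a≤δ) (_ ∷ δ≤b)
    with Flip-squeeze (suc h) δ (trans (sym (dyckFrom-u h _)) dy) f a≤δ δ≤b
  ... | inj₁ refl = inj₁ refl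
  ... | inj₂ refl = inj₂ refl
  Flip-squeeze zero    (d ∷ δ) dy (after u f) (() ∷ _) _
  Flip-squeeze (suc h) (d ∷ δ) dy (after u f) (2+h≤h ∷ _) _ = ⊥-elim (2+n≰n 2+h≤h)
  Flip-squeeze (suc h) (d ∷ δ) dy (after d f) (_ ∷ a≤δ) (_ ∷ δ≤b) with Flip-squeeze h δ dy f a≤δ δ≤b
  ... | inj₁ refl = inj₁ refl
  ... | inj₂ refl = inj₂ refl
  Flip-squeeze (suc h) (u ∷ δ) dy (after d f) _ (2+h≤h ∷ _) = ⊥-elim (2+n≰n 2+h≤h)
  Flip-squeeze (suc h) (u ∷ d ∷ δ) dy valley (_ ∷ _ ∷ a≤δ) (_ ∷ _ ∷ δ≤b) = inj₂ (cong (λ w → u ∷ d ∷ w) (≤[]-antisym δ≤b a≤δ))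
  Flip-squeeze (suc h) (d ∷ u ∷ δ) dy valley (_ ∷ _ ∷ a≤δ) (_ ∷ _ ∷ δ≤b) = inj₁ (cong (λ w → d ∷ u ∷ w) (≤[]-antisym δ≤b a≤δ))
  Flip-squeeze (suc h) (u ∷ u ∷ δ) dy valley _ (_ ∷ 3+h≤1+h ∷ _) = ⊥-elim (2+n≰n 3+h≤1+h)
  Flip-squeeze (suc zero)    (d ∷ d ∷ δ) dy valley (_ ∷ () ∷ _) _
  Flip-squeeze (suc (suc h)) (d ∷ d ∷ δ) dy valley (_ ∷ 2+h≤h ∷ _) _ = ⊥-elim (2+n≰n 2+h≤h)
  Flip-squeeze (suc h) (u ∷ []) dy valley _ (_ ∷ ())
  Flip-squeeze (suc h) (d ∷ []) dy valley (_ ∷ ()) _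

  -- H ∷ heights H e is the height profile of a path whose first step ends at height H; the valley
  -- to flip is the first one of d ∷ c.
  descent-Flip-below : ∀ h c H e → dyckFrom h (d ∷ c) ≡ true → dyckFrom H e ≡ true →
    Pointwise _≤_ (heights h (d ∷ c)) (H ∷ heights H e) → h < H →
    ∃ λ f → Flip (d ∷ c) f × Pointwise _≤_ (heights h f) (H ∷ heights H e)
  descent-Flip-below (suc h) (u ∷ c) H e dc de (_ ∷ c≤e) h<H = u ∷ d ∷ c , valley , h<H ∷ c≤e
  descent-Flip-below (suc (suc h)) (d ∷ c) (suc H) (u ∷ e) dc de (h≤H ∷ c≤e) (s≤s h<H)
    with descent-Flip-below (suc h) c (suc (suc H)) e dc de c≤e (≤-trans h<H (≤-trans (n≤1+n H) (n≤1+n (suc H))))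
  ... | f , flip , f≤e = d ∷ f , after d flip , h≤H ∷ f≤e
  descent-Flip-below (suc (suc h)) (d ∷ c) (suc H) (d ∷ e) dc de (h≤H ∷ c≤e) (s≤s h<H)
    with descent-Flip-below (suc h) c H e dc de c≤e h<H
  ... | f , flip , f≤e = d ∷ f , after d flip , h≤H ∷ f≤e
  descent-Flip-below (suc zero) [] zero [] dc de _ ()
  descent-Flip-below (suc zero) [] (suc H) [] dc () _ _
  descent-Flip-below (suc zero) [] H (u ∷ e) dc de (_ ∷ ()) _
  descent-Flip-below (suc zero) [] zero (d ∷ e) dc de (_ ∷ ()) _
  descent-Flip-below (suc zero) [] (suc H) (d ∷ e) dc de (_ ∷ ()) _
  descent-Flip-below (suc (suc h)) (d ∷ c) (suc H) [] dc de (_ ∷ ()) _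

  Flip-below : ∀ h a e → dyckFrom h a ≡ true → dyckFrom h e ≡ true → a ≤[ h ] e → a ≢ e →
    ∃ λ f → Flip a f × f ≤[ h ] e
  Flip-below h       []      []      da de a≤e a≢e = ⊥-elim (a≢e refl)
  Flip-below h       []      (u ∷ e) da de () a≢e
  Flip-below zero    []      (d ∷ e) da de () a≢e
  Flip-below (suc h) []      (d ∷ e) da de () a≢e
  Flip-below h       (u ∷ a) (u ∷ e) da de (_ ∷ a≤e) a≢e
    with Flip-below (suc h) a e (trans (sym (dyckFrom-u h a)) da) (trans (sym (dyckFrom-u h e)) de) a≤e (a≢e ∘ cong (u ∷_))
  ... | f , flip , f≤e = u ∷ f , after u flip , ≤-refl ∷ f≤e
  Flip-below (suc h) (d ∷ a) (d ∷ e) da de (_ ∷ a≤e) a≢e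
    with Flip-below h a e da de a≤e (a≢e ∘ cong (d ∷_))
  ... | f , flip , f≤e = d ∷ f , after d flip , ≤-refl ∷ f≤e
  Flip-below (suc h) (u ∷ a) (d ∷ e) da de (2+h≤h ∷ _) a≢e = ⊥-elim (2+n≰n 2+h≤h)
  Flip-below h       (d ∷ a) (u ∷ e) da de a≤e a≢e =
    descent-Flip-below h a (suc h) e da (trans (sym (dyckFrom-u h e)) de) a≤e ≤-refl

  valleyFlips-unique : ∀ w → Unique (valleyFlips w)
  valleyFlips-unique []          = []
  valleyFlips-unique (u ∷ w)     = map⁺ ∷-injectiveʳ (valleyFlips-unique w)
  valleyFlips-unique (d ∷ [])    = []
  valleyFlips-unique (d ∷ u ∷ w) = peak∉ ∷ map⁺ ∷-injectiveʳ (valleyFlips-unique (u ∷ w))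
    where
    peak∉ : All ((u ∷ d ∷ w) ≢_) (map (d ∷_) (valleyFlips (u ∷ w)))
    peak∉ = All.map⁺ (universal (λ _ ()) (valleyFlips (u ∷ w)))
  valleyFlips-unique (d ∷ d ∷ w) = map⁺ ∷-injectiveʳ (valleyFlips-unique (d ∷ w))

  ∧-true : ∀ {a b} → a ≡ true → b ≡ true → a ∧ b ≡ true
  ∧-true refl refl = refl

  allLe⇒Pointwise : ∀ xs ys → allLe xs ys ≡ true → Pointwise _≤_ xs ys
  allLe⇒Pointwise []       []       _ = []
  allLe⇒Pointwise (x ∷ xs) (y ∷ ys) e =
    ≤ᵇ⇒≤ x y (subst T (sym (∧-conicalˡ _ _ e)) _) ∷ allLe⇒Pointwise xs ys (∧-conicalʳ _ _ e)

  Pointwise⇒allLe : ∀ {xs ys} → Pointwise _≤_ xs ys → allLe xs ys ≡ true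
  Pointwise⇒allLe []           = refl
  Pointwise⇒allLe (x≤y ∷ xs≤ys) = ∧-true (T⇒≡true (≤⇒≤ᵇ x≤y)) (Pointwise⇒allLe xs≤ys)
    where
    T⇒≡true : ∀ {b} → T b → b ≡ true
    T⇒≡true {true} _ = refl

  ≢⇒eqW≡false : ∀ {a b} → a ≢ b → eqW a b ≡ false
  ≢⇒eqW≡false {a} {b} a≢b with eqW a b in e
  ... | true  = ⊥-elim (a≢b (eqW⇒≡ a b e))
  ... | false = refl

  ltD⇒ : ∀ a b → ltD a b ≡ true → a ≤[ 0 ] b × a ≢ b
  ltD⇒ a b lt = allLe⇒Pointwise _ _ (∧-conicalˡ (leqD a b) _ lt) , a≢b
    where
    a≢b : a ≢ b
    a≢b refl with () ← trans (cong not (sym (eqW-refl a))) (∧-conicalʳ (leqD a a) _ lt)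

  ltD⇐ : ∀ a b → a ≤[ 0 ] b → a ≢ b → ltD a b ≡ true
  ltD⇐ a b a≤b a≢b = ∧-true (Pointwise⇒allLe a≤b) (cong not (≢⇒eqW≡false a≢b))

  module _ {X : Set} (p : X → Bool) where

    any-true : ∀ {x} xs → x ∈ xs → p x ≡ true → any p xs ≡ true
    any-true (y ∷ xs) (here refl) px = cong (_∨ any p xs) px
    any-true (y ∷ xs) (there x∈)  px = trans (cong (p y ∨_) (any-true xs x∈ px)) (∨-zeroʳ (p y))

    any-false : ∀ xs → (∀ x → p x ≡ false) → any p xs ≡ false
    any-false []       _   = refl
    any-false (x ∷ xs) ¬px = cong₂ _∨_ (¬px x) (any-false xs ¬px)

  _≟W_ : DecidableEquality Word
  _≟W_ = ≡-dec step≟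
    where
    step≟ : DecidableEquality Step
    step≟ u u = yes refl
    step≟ u d = no λ ()
    step≟ d u = no λ ()
    step≟ d d = yes refl

  coversD⇒¬between : ∀ n a b {δ} → coversD n a b ≡ true → δ ∈ dyck n → ltD a δ ≡ true → ltD δ b ≡ true → ⊥
  coversD⇒¬between n a b cov δ∈ a<δ δ<b
    with () ← trans (cong not (sym (any-true (λ δ → ltD a δ ∧ ltD δ b) (dyck n) δ∈ (∧-true a<δ δ<b)))) (∧-conicalʳ (ltD a b) _ cov)

  coversD⇒Flip : ∀ n a b → IsDyck n a → IsDyck n b → coversD n a b ≡ true → Flip a b
  coversD⇒Flip n a b (da , la) (db , _) cov
    with a≤b , a≢b ← ltD⇒ a b (∧-conicalˡ (ltD a b) _ cov)
    with f , a⋖f , f≤b ← Flip-below 0 a b da db a≤b a≢b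
    with f ≟W b
  ... | yes refl = a⋖f
  ... | no  f≢b  = ⊥-elim (coversD⇒¬between n a b cov
        (∈-dyck⁺ n (Flip-dyckFrom 0 a⋖f da , trans (Flip-length a⋖f) la))
        (ltD⇐ a f (Flip-≤ 0 da a⋖f) (Flip-≢ a⋖f)) (ltD⇐ f b f≤b f≢b))

  Flip⇒coversD : ∀ n a {b} → IsDyck n a → Flip a b → coversD n a b ≡ true
  Flip⇒coversD n a {b} (da , _) a⋖b =
    ∧-true (ltD⇐ a b (Flip-≤ 0 da a⋖b) (Flip-≢ a⋖b)) (cong not (any-false _ (dyck n) nothing-between))
    where
    nothing-between : ∀ δ → ltD a δ ∧ ltD δ b ≡ false
    nothing-between δ with ltD a δ in a<δ | ltD δ b in δ<b
    ... | false | _     = refl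
    ... | true  | false = refl
    ... | true  | true  with Flip-squeeze 0 δ da a⋖b (proj₁ (ltD⇒ a δ a<δ)) (proj₁ (ltD⇒ δ b δ<b))
    ...   | inj₁ refl = ⊥-elim (proj₂ (ltD⇒ a a a<δ) refl)
    ...   | inj₂ refl = ⊥-elim (proj₂ (ltD⇒ b b δ<b) refl)

  sumFlips : (Word → ℕ) → Word → ℕ
  sumFlips f w = sum (map f (valleyFlips w))

  sum-coversD : ∀ n a → IsDyck n a → ∀ (f : Word → ℕ) →
    sum (map (λ b → boolToℕ (coversD n a b) * f b) (dyck n)) ≡ sumFlips f a
  sum-coversD n a a∈ f = begin
    sum (map (λ b → boolToℕ (coversD n a b) * f b) (dyck n)) ≡⟨ sym (sum-map-filter (coversD n a) f (dyck n)) ⟩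
    sum (map f (filter covers? (dyck n)))                    ≡⟨ sum-↭ (Permutation.map⁺ f covers↭valleyFlips) ⟩
    sumFlips f a                                             ∎
    where
    open ≡-Reasoning
    covers? : ∀ b → Dec (coversD n a b ≡ true)
    covers? b = Data.Bool._≟_ (coversD n a b) true
    covers↭valleyFlips : filter covers? (dyck n) ↭ valleyFlips a
    covers↭valleyFlips = ∼bag⇒↭ (unique∧set⇒bag (filter⁺ covers? (dyck-unique n)) (valleyFlips-unique a) (mk⇔ to from))
      where
      to : ∀ {b} → b ∈ filter covers? (dyck n) → b ∈ valleyFlips a
      to b∈ with b∈dyck , cov ← ∈-filter⁻ covers? {xs = dyck n} b∈ = Flip⇒∈ (coversD⇒Flip n a _ a∈ (∈-dyck⁻ n b∈dyck) cov)
      from : ∀ {b} → b ∈ valleyFlips a → b ∈ filter covers? (dyck n)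
      from {b} b∈ = ∈-filter⁺ covers? (∈-dyck⁺ n (Flip-dyckFrom 0 a⋖b (proj₁ a∈) , trans (Flip-length a⋖b) (proj₂ a∈))) (Flip⇒coversD n a a∈ a⋖b)
        where
        a⋖b : Flip a b
        a⋖b = ∈⇒Flip a b∈

  -- Saturated chains

  valleys : Word → ℕ
  valleys = occ (d ∷ u ∷ [])

  startsWithU : Word → ℕ
  startsWithU w = boolToℕ (isPrefix (u ∷ []) w)

  ddu duu dduu dudu duuu dddu : Word
  ddu  = d ∷ d ∷ u ∷ []
  duu  = d ∷ u ∷ u ∷ []
  dduu = d ∷ d ∷ u ∷ u ∷ []
  dudu = d ∷ u ∷ d ∷ u ∷ []
  duuu = d ∷ u ∷ u ∷ u ∷ []
  dddu = d ∷ d ∷ d ∷ u ∷ []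

  length-valleyFlips : ∀ w → length (valleyFlips w) ≡ valleys w
  length-valleyFlips []          = refl
  length-valleyFlips (u ∷ w)     = trans (length-map (u ∷_) (valleyFlips w)) (length-valleyFlips w)
  length-valleyFlips (d ∷ [])    = refl
  length-valleyFlips (d ∷ u ∷ w) = cong suc (trans (length-map (d ∷_) (valleyFlips (u ∷ w))) (length-valleyFlips (u ∷ w)))
  length-valleyFlips (d ∷ d ∷ w) = trans (length-map (d ∷_) (valleyFlips (d ∷ w))) (length-valleyFlips (d ∷ w))

  sumFlips-u : ∀ f w → sumFlips f (u ∷ w) ≡ sumFlips (f ∘ (u ∷_)) w
  sumFlips-u f w = sum-map-∘ f (u ∷_) (valleyFlips w)

  sumFlips-du : ∀ f w → sumFlips f (d ∷ u ∷ w) ≡ f (u ∷ d ∷ w) + sumFlips (f ∘ (d ∷_)) (u ∷ w)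
  sumFlips-du f w = cong (f (u ∷ d ∷ w) +_) (sum-map-∘ f (d ∷_) (valleyFlips (u ∷ w)))

  sumFlips-dd : ∀ f w → sumFlips f (d ∷ d ∷ w) ≡ sumFlips (f ∘ (d ∷_)) (d ∷ w)
  sumFlips-dd f w = sum-map-∘ f (d ∷_) (valleyFlips (d ∷ w))

  sumFlips-cong : ∀ {f g} → (∀ b → f b ≡ g b) → ∀ w → sumFlips f w ≡ sumFlips g w
  sumFlips-cong f≡g w = sum-map-cong (valleyFlips w) (λ {b} _ → f≡g b)

  sumFlips-+ : ∀ f g w → sumFlips (λ b → f b + g b) w ≡ sumFlips f w + sumFlips g w
  sumFlips-+ f g w = sum-map-+ f g (valleyFlips w)

  sumFlips-*ˡ : ∀ c f w → sumFlips (λ b → c * f b) w ≡ c * sumFlips f w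
  sumFlips-*ˡ c f w = sum-map-*ˡ c f (valleyFlips w)

  sumFlips-const : ∀ c w → sumFlips (λ _ → c) w ≡ c * valleys w
  sumFlips-const c w = trans (sum-map-const (valleyFlips w)) (cong (c *_) (length-valleyFlips w))
    where
    sum-map-const : ∀ (bs : List Word) → sum (map (λ _ → c) bs) ≡ c * length bs
    sum-map-const []       = sym (*-zeroʳ c)
    sum-map-const (b ∷ bs) = trans (cong (c +_) (sum-map-const bs)) (sym (*-suc c (length bs)))

  sumFlips-startsWithU-u : ∀ w → sumFlips startsWithU (u ∷ w) ≡ valleys w
  sumFlips-startsWithU-u w = trans (sumFlips-u startsWithU w) (trans (sumFlips-const 1 w) (*-identityˡ (valleys w)))

  sumFlips-startsWithU-d : ∀ w → sumFlips startsWithU (d ∷ w) ≡ startsWithU w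
  sumFlips-startsWithU-d []      = refl
  sumFlips-startsWithU-d (u ∷ w) = trans (sumFlips-du startsWithU w) (cong suc (sumFlips-const 0 (u ∷ w)))
  sumFlips-startsWithU-d (d ∷ w) = trans (sumFlips-dd startsWithU w) (sumFlips-const 0 (d ∷ w))

  twoChains : Word → ℕ
  twoChains = sumFlips valleys

  twoChains-u : ∀ w → twoChains (u ∷ w) ≡ twoChains w
  twoChains-u = sumFlips-u valleys

  twoChainGain : Word → ℕ
  twoChainGain []      = 0
  twoChainGain (u ∷ w) = startsWithU w + 2 * valleys w
  twoChainGain (d ∷ w) = startsWithU w

  twoChains-d : ∀ w → twoChains (d ∷ w) ≡ twoChainGain w + twoChains w
  twoChains-d []      = refl
  twoChains-d (u ∷ w) = begin
    twoChains (d ∷ u ∷ w)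
      ≡⟨ sumFlips-du valleys w ⟩
    valleys (d ∷ w) + sumFlips (λ b → startsWithU b + valleys b) (u ∷ w)
      ≡⟨ cong (valleys (d ∷ w) +_) (sumFlips-+ startsWithU valleys (u ∷ w)) ⟩
    valleys (d ∷ w) + (sumFlips startsWithU (u ∷ w) + twoChains (u ∷ w))
      ≡⟨ cong (λ x → valleys (d ∷ w) + (x + twoChains (u ∷ w))) (sumFlips-startsWithU-u w) ⟩
    startsWithU w + valleys w + (valleys w + twoChains (u ∷ w))
      ≡⟨ regroup (startsWithU w) (valleys w) (twoChains (u ∷ w)) ⟩
    startsWithU w + 2 * valleys w + twoChains (u ∷ w) ∎
    where
    open ≡-Reasoning
    regroup : ∀ s v t → s + v + (v + t) ≡ s + 2 * v + t
    regroup = solve-∀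
  twoChains-d (d ∷ w) = begin
    twoChains (d ∷ d ∷ w)                                                 ≡⟨ sumFlips-dd valleys w ⟩
    sumFlips (λ b → startsWithU b + valleys b) (d ∷ w)                   ≡⟨ sumFlips-+ startsWithU valleys (d ∷ w) ⟩
    sumFlips startsWithU (d ∷ w) + twoChains (d ∷ w)                     ≡⟨ cong (_+ twoChains (d ∷ w)) (sumFlips-startsWithU-d w) ⟩
    startsWithU w + twoChains (d ∷ w)                                    ∎
    where open ≡-Reasoning

  twoChains-formula : ∀ w → twoChains w ≡ valleys w ↓ 2 + occ ddu w + occ duu w
  twoChains-formula []          = refl
  twoChains-formula (u ∷ w)     = trans (twoChains-u w) (twoChains-formula w)
  twoChains-formula (d ∷ [])    = refl
  twoChains-formula (d ∷ u ∷ w) = begin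
    twoChains (d ∷ u ∷ w)
      ≡⟨ twoChains-d (u ∷ w) ⟩
    startsWithU w + 2 * valleys w + twoChains (u ∷ w)
      ≡⟨ cong (startsWithU w + 2 * valleys w +_) (trans (twoChains-u w) (twoChains-formula w)) ⟩
    startsWithU w + 2 * valleys w + (valleys w ↓ 2 + occ ddu w + occ duu w)
      ≡⟨ regroup (startsWithU w) (valleys w) (valleys w ↓ 2) (occ ddu w) (occ duu w) ⟩
    valleys w ↓ 2 + 2 * valleys w + occ ddu w + (startsWithU w + occ duu w)
      ≡⟨ cong (λ x → x + occ ddu w + (startsWithU w + occ duu w)) (sym (↓2-suc (valleys w))) ⟩
    suc (valleys w) ↓ 2 + occ ddu w + (startsWithU w + occ duu w) ∎
    where
    open ≡-Reasoning
    regroup : ∀ s v f p q → s + 2 * v + (f + p + q) ≡ f + 2 * v + p + (s + q)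
    regroup = solve-∀
  twoChains-formula (d ∷ d ∷ w) = begin
    twoChains (d ∷ d ∷ w)
      ≡⟨ twoChains-d (d ∷ w) ⟩
    startsWithU w + twoChains (d ∷ w)
      ≡⟨ cong (startsWithU w +_) (twoChains-formula (d ∷ w)) ⟩
    startsWithU w + (valleys (d ∷ w) ↓ 2 + occ ddu (d ∷ w) + occ duu (d ∷ w))
      ≡⟨ regroup (startsWithU w) (valleys (d ∷ w) ↓ 2) (occ ddu (d ∷ w)) (occ duu (d ∷ w)) ⟩
    valleys (d ∷ w) ↓ 2 + (startsWithU w + occ ddu (d ∷ w)) + occ duu (d ∷ w) ∎
    where
    open ≡-Reasoning
    regroup : ∀ s f p q → s + (f + p + q) ≡ f + (s + p) + q
    regroup = solve-∀

  threeChains : Word → ℕ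
  threeChains = sumFlips twoChains

  threeChains-u : ∀ w → threeChains (u ∷ w) ≡ threeChains w
  threeChains-u w = trans (sumFlips-u twoChains w) (sumFlips-cong twoChains-u w)

  threeChains-du : ∀ w → threeChains (d ∷ u ∷ w) ≡ twoChains (d ∷ w) + (sumFlips startsWithU w + 2 * twoChains w) + threeChains w
  threeChains-du w = begin
    threeChains (d ∷ u ∷ w)
      ≡⟨ sumFlips-du twoChains w ⟩
    twoChains (u ∷ d ∷ w) + sumFlips (twoChains ∘ (d ∷_)) (u ∷ w)
      ≡⟨ cong₂ _+_ (twoChains-u (d ∷ w)) (sumFlips-cong twoChains-d (u ∷ w)) ⟩
    twoChains (d ∷ w) + sumFlips (λ b → twoChainGain b + twoChains b) (u ∷ w)
      ≡⟨ cong (twoChains (d ∷ w) +_) (sumFlips-+ twoChainGain twoChains (u ∷ w)) ⟩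
    twoChains (d ∷ w) + (sumFlips twoChainGain (u ∷ w) + threeChains (u ∷ w))
      ≡⟨ cong₂ (λ x y → twoChains (d ∷ w) + (x + y)) gain-u (threeChains-u w) ⟩
    twoChains (d ∷ w) + (sumFlips startsWithU w + 2 * twoChains w + threeChains w)
      ≡⟨ sym (+-assoc (twoChains (d ∷ w)) _ _) ⟩
    twoChains (d ∷ w) + (sumFlips startsWithU w + 2 * twoChains w) + threeChains w ∎
    where
    open ≡-Reasoning
    gain-u : sumFlips twoChainGain (u ∷ w) ≡ sumFlips startsWithU w + 2 * twoChains w
    gain-u = trans (sumFlips-u twoChainGain w)
      (trans (sumFlips-+ startsWithU (λ b → 2 * valleys b) w) (cong (sumFlips startsWithU w +_) (sumFlips-*ˡ 2 valleys w)))

  threeChains-dd : ∀ w → threeChains (d ∷ d ∷ w) ≡ sumFlips twoChainGain (d ∷ w) + threeChains (d ∷ w)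
  threeChains-dd w = begin
    threeChains (d ∷ d ∷ w)                                       ≡⟨ sumFlips-dd twoChains w ⟩
    sumFlips (twoChains ∘ (d ∷_)) (d ∷ w)                         ≡⟨ sumFlips-cong twoChains-d (d ∷ w) ⟩
    sumFlips (λ b → twoChainGain b + twoChains b) (d ∷ w)         ≡⟨ sumFlips-+ twoChainGain twoChains (d ∷ w) ⟩
    sumFlips twoChainGain (d ∷ w) + threeChains (d ∷ w)           ∎
    where open ≡-Reasoning

  sumFlips-twoChainGain-du : ∀ w → sumFlips twoChainGain (d ∷ u ∷ w) ≡ 2 * valleys (d ∷ w) + valleys w
  sumFlips-twoChainGain-du w = trans (sumFlips-du twoChainGain w) (cong (2 * valleys (d ∷ w) +_) (sumFlips-startsWithU-u w))

  sumFlips-twoChainGain-dd : ∀ w → sumFlips twoChainGain (d ∷ d ∷ w) ≡ startsWithU w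
  sumFlips-twoChainGain-dd w = trans (sumFlips-dd twoChainGain w) (sumFlips-startsWithU-d w)

  identity-from-recurrence : ∀ {t t′ e e′ r r′} g → t ≡ g + t′ → t′ + e′ ≡ r′ → g + e + r′ ≡ r + e′ → t + e ≡ r
  identity-from-recurrence {t} {t′} {e} {e′} {r} {r′} g t≡g+t′ t′+e′≡r′ g+e+r′≡r+e′ = +-cancelʳ-≡ e′ (t + e) r (begin
    t + e + e′       ≡⟨ cong (λ x → x + e + e′) t≡g+t′ ⟩
    g + t′ + e + e′  ≡⟨ regroup g t′ e e′ ⟩
    g + e + (t′ + e′) ≡⟨ cong (g + e +_) t′+e′≡r′ ⟩
    g + e + r′       ≡⟨ g+e+r′≡r+e′ ⟩
    r + e′           ∎)
    where
    open ≡-Reasoning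
    regroup : ∀ a b c e → a + b + c + e ≡ a + c + (b + e)
    regroup = solve-∀

  ThreeChainsIdentity : Word → Set
  ThreeChainsIdentity w = threeChains w + 3 * (occ ddu w + occ duu w) ≡
    valleys w ↓ 3 + 3 * valleys w * (occ ddu w + occ duu w) + 2 * occ dduu w + 2 * occ dudu w + occ duuu w + occ dddu w

  threeChainsIdentity-ddu : ∀ w → ThreeChainsIdentity (d ∷ u ∷ w) → ThreeChainsIdentity (d ∷ d ∷ u ∷ w)
  threeChainsIdentity-ddu w identity =
    identity-from-recurrence (2 * valleys (d ∷ w) + valleys w)
      (trans (threeChains-dd (u ∷ w)) (cong (_+ threeChains (d ∷ u ∷ w)) (sumFlips-twoChainGain-du w)))
      identity
      (bookkeeping (startsWithU w) (valleys w) (valleys (d ∷ u ∷ w) ↓ 3) (occ ddu (d ∷ u ∷ w)) (occ duu (d ∷ u ∷ w))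
        (occ dduu (d ∷ u ∷ w)) (occ dudu (d ∷ u ∷ w)) (occ duuu (d ∷ u ∷ w)) (occ dddu (d ∷ u ∷ w)))
    where
    bookkeeping : ∀ s v f p q a b c e →
      2 * (s + v) + v + 3 * (1 + p + q) + (f + 3 * (1 + v) * (p + q) + 2 * a + 2 * b + c + e) ≡
      f + 3 * (1 + v) * (1 + p + q) + 2 * (s + a) + 2 * b + c + e + 3 * (p + q)
    bookkeeping = solve-∀

  threeChainsIdentity-ddd : ∀ w → ThreeChainsIdentity (d ∷ d ∷ w) → ThreeChainsIdentity (d ∷ d ∷ d ∷ w)
  threeChainsIdentity-ddd w identity =
    identity-from-recurrence (startsWithU w)
      (trans (threeChains-dd (d ∷ w)) (cong (_+ threeChains (d ∷ d ∷ w)) (sumFlips-twoChainGain-dd w)))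
      identity
      (bookkeeping (startsWithU w) (valleys (d ∷ d ∷ w)) (valleys (d ∷ d ∷ w) ↓ 3) (occ ddu (d ∷ d ∷ w)) (occ duu (d ∷ d ∷ w))
        (occ dduu (d ∷ d ∷ w)) (occ dudu (d ∷ d ∷ w)) (occ duuu (d ∷ d ∷ w)) (occ dddu (d ∷ d ∷ w)))
    where
    bookkeeping : ∀ s v f p q a b c e →
      s + 3 * (p + q) + (f + 3 * v * (p + q) + 2 * a + 2 * b + c + e) ≡
      f + 3 * v * (p + q) + 2 * a + 2 * b + c + (s + e) + 3 * (p + q)
    bookkeeping = solve-∀

  threeChainsIdentity-duu : ∀ w → ThreeChainsIdentity (u ∷ w) → ThreeChainsIdentity (d ∷ u ∷ u ∷ w)
  threeChainsIdentity-duu w identity rewrite ↓-pascal (valleys w) 2 =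
    identity-from-recurrence gain recurrence identity
      (bookkeeping (startsWithU w) (valleys w) (valleys w ↓ 2) (valleys w ↓ 3) (occ ddu w) (occ duu w)
        (occ dduu w) (occ dudu w) (occ duuu w) (occ dddu w))
    where
    twoChains-w gain : ℕ
    twoChains-w = valleys w ↓ 2 + occ ddu w + occ duu w
    gain = valleys w ↓ 2 + 2 * valleys w + occ ddu w + (startsWithU w + occ duu w) + (valleys w + 2 * twoChains-w)
    recurrence : threeChains (d ∷ u ∷ u ∷ w) ≡ gain + threeChains (u ∷ w)
    recurrence = trans (threeChains-du (u ∷ w)) (cong (_+ threeChains (u ∷ w)) (cong₂ _+_
      (trans (twoChains-formula (d ∷ u ∷ w)) (cong (λ x → x + occ ddu w + (startsWithU w + occ duu w)) (↓2-suc (valleys w))))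
      (cong₂ (λ x y → x + 2 * y) (sumFlips-startsWithU-u w) (trans (twoChains-u w) (twoChains-formula w)))))
    bookkeeping : ∀ s v f₂ f₃ p q a b c e →
      f₂ + 2 * v + p + (s + q) + (v + 2 * (f₂ + p + q)) + 3 * (p + (1 + q)) + (f₃ + 3 * v * (p + q) + 2 * a + 2 * b + c + e) ≡
      f₃ + 3 * f₂ + 3 * (1 + v) * (p + (1 + q)) + 2 * a + 2 * b + (s + c) + e + 3 * (p + q)
    bookkeeping = solve-∀

  threeChainsIdentity-dud : ∀ w → ThreeChainsIdentity (d ∷ w) → ThreeChainsIdentity (d ∷ u ∷ d ∷ w)
  threeChainsIdentity-dud w identity rewrite ↓-pascal (valleys (d ∷ w)) 2 =
    identity-from-recurrence gain recurrence identity
      (bookkeeping (startsWithU w) (valleys (d ∷ w)) (valleys (d ∷ w) ↓ 2) (valleys (d ∷ w) ↓ 3) (occ ddu (d ∷ w)) (occ duu (d ∷ w))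
        (occ dduu (d ∷ w)) (occ dudu (d ∷ w)) (occ duuu (d ∷ w)) (occ dddu (d ∷ w)))
    where
    twoChains-dw gain : ℕ
    twoChains-dw = valleys (d ∷ w) ↓ 2 + occ ddu (d ∷ w) + occ duu (d ∷ w)
    gain = valleys (d ∷ w) ↓ 2 + (startsWithU w + occ ddu (d ∷ w)) + occ duu (d ∷ w) + (startsWithU w + 2 * twoChains-dw)
    recurrence : threeChains (d ∷ u ∷ d ∷ w) ≡ gain + threeChains (d ∷ w)
    recurrence = trans (threeChains-du (d ∷ w)) (cong (_+ threeChains (d ∷ w)) (cong₂ _+_
      (twoChains-formula (d ∷ d ∷ w))
      (cong₂ (λ x y → x + 2 * y) (sumFlips-startsWithU-d w) (twoChains-formula (d ∷ w)))))
    bookkeeping : ∀ s v f₂ f₃ p q a b c e →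
      f₂ + (s + p) + q + (s + 2 * (f₂ + p + q)) + 3 * (p + q) + (f₃ + 3 * v * (p + q) + 2 * a + 2 * b + c + e) ≡
      f₃ + 3 * f₂ + 3 * (1 + v) * (p + q) + 2 * a + 2 * (s + b) + c + e + 3 * (p + q)
    bookkeeping = solve-∀

  threeChains-formula : ∀ w → ThreeChainsIdentity w
  threeChains-formula []              = refl
  threeChains-formula (u ∷ w)         = trans (cong (_+ 3 * (occ ddu w + occ duu w)) (threeChains-u w)) (threeChains-formula w)
  threeChains-formula (d ∷ [])        = refl
  threeChains-formula (d ∷ d ∷ [])    = refl
  threeChains-formula (d ∷ u ∷ [])    = refl
  threeChains-formula (d ∷ d ∷ u ∷ w) = threeChainsIdentity-ddu w (threeChains-formula (d ∷ u ∷ w))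
  threeChains-formula (d ∷ d ∷ d ∷ w) = threeChainsIdentity-ddd w (threeChains-formula (d ∷ d ∷ w))
  threeChains-formula (d ∷ u ∷ u ∷ w) = threeChainsIdentity-duu w (threeChains-formula (u ∷ w))
  threeChains-formula (d ∷ u ∷ d ∷ w) = threeChainsIdentity-dud w (threeChains-formula (d ∷ w))

  boolToℕ-∧ : ∀ x y → boolToℕ (x ∧ y) ≡ boolToℕ x * boolToℕ y
  boolToℕ-∧ false y = refl
  boolToℕ-∧ true  y = sym (+-identityʳ (boolToℕ y))

  threeChains-from : ∀ n a → IsDyck n a →
    sum (map (λ b → sum (map (λ c → sum (map (λ e → boolToℕ (coversD n a b ∧ coversD n b c ∧ coversD n c e))
      (dyck n))) (dyck n))) (dyck n)) ≡ threeChains a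
  threeChains-from n a a∈ = begin
    sum (map (λ b → sum (map (λ c → sum (map (λ e → boolToℕ (coversD n a b ∧ coversD n b c ∧ coversD n c e)) (dyck n))) (dyck n))) (dyck n))
      ≡⟨ sum-map-cong (dyck n) (λ {b} _ → sum-map-cong (dyck n) (λ {c} _ → factor b c)) ⟩
    sum (map (λ b → sum (map (λ c → [ a ⋖ b ] * ([ b ⋖ c ] * sum (map (λ e → [ c ⋖ e ]) (dyck n)))) (dyck n))) (dyck n))
      ≡⟨ sum-map-cong (dyck n) (λ {b} _ → sum-map-*ˡ [ a ⋖ b ] _ (dyck n)) ⟩
    sum (map (λ b → [ a ⋖ b ] * sum (map (λ c → [ b ⋖ c ] * sum (map (λ e → [ c ⋖ e ]) (dyck n))) (dyck n))) (dyck n))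
      ≡⟨ sum-map-cong (dyck n) (λ {b} b∈ → cong ([ a ⋖ b ] *_) (trans
           (sum-map-cong (dyck n) (λ {c} c∈ → cong ([ b ⋖ c ] *_) (covers-count c (∈-dyck⁻ n c∈))))
           (sum-coversD n b (∈-dyck⁻ n b∈) valleys))) ⟩
    sum (map (λ b → [ a ⋖ b ] * twoChains b) (dyck n))
      ≡⟨ sum-coversD n a a∈ twoChains ⟩
    threeChains a ∎
    where
    open ≡-Reasoning
    [_⋖_] : Word → Word → ℕ
    [ x ⋖ y ] = boolToℕ (coversD n x y)
    factor : ∀ b c → sum (map (λ e → boolToℕ (coversD n a b ∧ coversD n b c ∧ coversD n c e)) (dyck n)) ≡
                     [ a ⋖ b ] * ([ b ⋖ c ] * sum (map (λ e → [ c ⋖ e ]) (dyck n)))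
    factor b c = begin
      sum (map (λ e → boolToℕ (coversD n a b ∧ coversD n b c ∧ coversD n c e)) (dyck n))
        ≡⟨ sum-map-cong (dyck n) (λ {e} _ → trans (boolToℕ-∧ (coversD n a b) _) (cong ([ a ⋖ b ] *_) (boolToℕ-∧ (coversD n b c) _))) ⟩
      sum (map (λ e → [ a ⋖ b ] * ([ b ⋖ c ] * [ c ⋖ e ])) (dyck n))
        ≡⟨ sum-map-*ˡ [ a ⋖ b ] _ (dyck n) ⟩
      [ a ⋖ b ] * sum (map (λ e → [ b ⋖ c ] * [ c ⋖ e ]) (dyck n))
        ≡⟨ cong ([ a ⋖ b ] *_) (sum-map-*ˡ [ b ⋖ c ] _ (dyck n)) ⟩
      [ a ⋖ b ] * ([ b ⋖ c ] * sum (map (λ e → [ c ⋖ e ]) (dyck n))) ∎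
    covers-count : ∀ c → IsDyck n c → sum (map (λ e → [ c ⋖ e ]) (dyck n)) ≡ valleys c
    covers-count c c∈ = trans (sum-map-cong (dyck n) (λ {e} _ → sym (*-identityʳ [ c ⋖ e ])))
      (trans (sum-coversD n c c∈ (λ _ → 1)) (trans (sumFlips-const 1 c) (*-identityˡ (valleys c))))

  sc3≡sum-threeChains : ∀ n → sc3 n ≡ sumDyck n threeChains
  sc3≡sum-threeChains n = sum-map-cong (dyck n) (λ {a} a∈ → threeChains-from n a (∈-dyck⁻ n a∈))

  -- The identity for threeChains, rearranged so that both correction terms are swapped by mirror.
  threeChains-balanced : ∀ w →
    threeChains w + 6 * occ duu w + (3 * (valleys w * occ duu w) + occ duuu w + 3 * occ ddu w) ≡
    2 * occ dduu w + 2 * occ dudu w + 2 * occ duuu w + valleys w ↓ 3 + 6 * (valleys w * occ duu w) +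
    (3 * (valleys w * occ ddu w) + occ dddu w + 3 * occ duu w)
  threeChains-balanced w = begin
    threeChains w + 6 * q + (3 * (v * q) + c + 3 * p)          ≡⟨ regroup (threeChains w) v p q c ⟩
    threeChains w + 3 * (p + q) + (3 * q + 3 * (v * q) + c)    ≡⟨ cong (_+ (3 * q + 3 * (v * q) + c)) (threeChains-formula w) ⟩
    v ↓ 3 + 3 * v * (p + q) + 2 * a + 2 * b + c + e + (3 * q + 3 * (v * q) + c) ≡⟨ rearrange (v ↓ 3) v p q a b c e ⟩
    2 * a + 2 * b + 2 * c + v ↓ 3 + 6 * (v * q) + (3 * (v * p) + e + 3 * q) ∎
    where
    open ≡-Reasoning
    v p q a b c e : ℕ
    v = valleys w
    p = occ ddu w
    q = occ duu w
    a = occ dduu w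
    b = occ dudu w
    c = occ duuu w
    e = occ dddu w
    regroup : ∀ t v p q c → t + 6 * q + (3 * (v * q) + c + 3 * p) ≡ t + 3 * (p + q) + (3 * q + 3 * (v * q) + c)
    regroup = solve-∀
    rearrange : ∀ f v p q a b c e →
      f + 3 * v * (p + q) + 2 * a + 2 * b + c + e + (3 * q + 3 * (v * q) + c) ≡
      2 * a + 2 * b + 2 * c + f + 6 * (v * q) + (3 * (v * p) + e + 3 * q)
    rearrange = solve-∀

  sc3-identity : ∀ n →
    sc3 n + 6 * sumDyck n (occ duu) ≡
    2 * sumDyck n (occ dduu) + 2 * sumDyck n (occ dudu) + 2 * sumDyck n (occ duuu) +
    sumDyck n (λ w → valleys w ↓ 3) + 6 * sumDyck n (λ w → valleys w * occ duu w)
  sc3-identity n = begin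
    sc3 n + 6 * sumDyck n (occ duu)                    ≡⟨ cong (_+ 6 * sumDyck n (occ duu)) (sc3≡sum-threeChains n) ⟩
    sumDyck n threeChains + 6 * sumDyck n (occ duu)   ≡⟨ cong (sumDyck n threeChains +_) (sym (sum-map-*ˡ 6 (occ duu) (dyck n))) ⟩
    sumDyck n threeChains + sumDyck n (λ w → 6 * occ duu w) ≡⟨ sym (sum-map-+ threeChains (λ w → 6 * occ duu w) (dyck n)) ⟩
    sumDyck n (λ w → threeChains w + 6 * occ duu w)   ≡⟨ +-cancelʳ-≡ (sumDyck n swapped) _ _ summed ⟩
    sumDyck n balanced                                 ≡⟨ split ⟩
    2 * sumDyck n (occ dduu) + 2 * sumDyck n (occ dudu) + 2 * sumDyck n (occ duuu) +
    sumDyck n (λ w → valleys w ↓ 3) + 6 * sumDyck n (λ w → valleys w * occ duu w) ∎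
    where
    open ≡-Reasoning
    swapped mirrored balanced : Word → ℕ
    swapped  w = 3 * (valleys w * occ duu w) + occ duuu w + 3 * occ ddu w
    mirrored w = 3 * (valleys w * occ ddu w) + occ dddu w + 3 * occ duu w
    balanced w = 2 * occ dduu w + 2 * occ dudu w + 2 * occ duuu w + valleys w ↓ 3 + 6 * (valleys w * occ duu w)
    swapped-mirror : ∀ w → swapped (mirror w) ≡ mirrored w
    swapped-mirror w = cong₂ _+_
      (cong₂ _+_ (cong (3 *_) (cong₂ _*_ (occ-mirror (d ∷ u ∷ []) w) (occ-mirror duu w))) (occ-mirror duuu w))
      (cong (3 *_) (occ-mirror ddu w))
    summed : sumDyck n (λ w → threeChains w + 6 * occ duu w) + sumDyck n swapped ≡ sumDyck n balanced + sumDyck n swapped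
    summed = begin
      sumDyck n (λ w → threeChains w + 6 * occ duu w) + sumDyck n swapped
        ≡⟨ sym (sum-map-+ _ swapped (dyck n)) ⟩
      sumDyck n (λ w → threeChains w + 6 * occ duu w + swapped w)
        ≡⟨ sum-map-cong (dyck n) (λ {w} _ → threeChains-balanced w) ⟩
      sumDyck n (λ w → balanced w + mirrored w)
        ≡⟨ sum-map-+ balanced mirrored (dyck n) ⟩
      sumDyck n balanced + sumDyck n mirrored
        ≡⟨ cong (sumDyck n balanced +_) (trans (sym (sum-map-cong (dyck n) (λ {w} _ → swapped-mirror w))) (sum-dyck-mirror n swapped)) ⟩
      sumDyck n balanced + sumDyck n swapped ∎
    split : sumDyck n balanced ≡
      2 * sumDyck n (occ dduu) + 2 * sumDyck n (occ dudu) + 2 * sumDyck n (occ duuu) +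
      sumDyck n (λ w → valleys w ↓ 3) + 6 * sumDyck n (λ w → valleys w * occ duu w)
    split = trans (sum-map-+ _ _ (dyck n)) (cong₂ _+_
      (trans (sum-map-+ _ _ (dyck n)) (cong (_+ sumDyck n (λ w → valleys w ↓ 3))
        (trans (sum-map-+ _ _ (dyck n)) (cong₂ _+_
          (trans (sum-map-+ _ _ (dyck n)) (cong₂ _+_ (sum-map-*ˡ 2 (occ dduu) (dyck n)) (sum-map-*ˡ 2 (occ dudu) (dyck n))))
          (sum-map-*ˡ 2 (occ duuu) (dyck n))))))
      (sum-map-*ˡ 6 (λ w → valleys w * occ duu w) (dyck n)))


open SaturatedChains
open import Data.Nat using () renaming (_+_ to _+ℕ_; _*_ to _*ℕ_)
open import Data.Integer using (+_; _+_; _*_; _-_)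
open import Data.Integer.Properties using (pos-+; pos-*)
import Data.Integer.Tactic.RingSolver as ℤ-Solver
open import Relation.Binary.PropositionalEquality using (_≡_; cong; cong₂; sym; trans; module ≡-Reasoning)

ℕ⇒ℤ-identity : ∀ s a b c v x y → s +ℕ 6 *ℕ y ≡ 2 *ℕ a +ℕ 2 *ℕ b +ℕ 2 *ℕ c +ℕ v +ℕ 6 *ℕ x →
  + s ≡ + 2 * + a + + 2 * + b + + 2 * + c + + v + + 6 * (+ x - + y)
ℕ⇒ℤ-identity s a b c v x y eq = begin
  + s                                                          ≡⟨ cancel (+ s) (+ y) ⟩
  + s + + 6 * + y - + 6 * + y                                  ≡⟨ cong (_- + 6 * + y) (sym lhs-homomorphic) ⟩
  + (s +ℕ 6 *ℕ y) - + 6 * + y                                  ≡⟨ cong (λ z → + z - + 6 * + y) eq ⟩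
  + (2 *ℕ a +ℕ 2 *ℕ b +ℕ 2 *ℕ c +ℕ v +ℕ 6 *ℕ x) - + 6 * + y    ≡⟨ cong (_- + 6 * + y) rhs-homomorphic ⟩
  + 2 * + a + + 2 * + b + + 2 * + c + + v + + 6 * + x - + 6 * + y ≡⟨ distrib (+ a) (+ b) (+ c) (+ v) (+ x) (+ y) ⟩
  + 2 * + a + + 2 * + b + + 2 * + c + + v + + 6 * (+ x - + y)  ∎
  where
  open ≡-Reasoning
  cancel : ∀ s y → s ≡ s + + 6 * y - + 6 * y
  cancel = ℤ-Solver.solve-∀
  distrib : ∀ a b c v x y → + 2 * a + + 2 * b + + 2 * c + v + + 6 * x - + 6 * y ≡ + 2 * a + + 2 * b + + 2 * c + v + + 6 * (x - y)
  distrib = ℤ-Solver.solve-∀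
  lhs-homomorphic : + (s +ℕ 6 *ℕ y) ≡ + s + + 6 * + y
  lhs-homomorphic = trans (pos-+ s (6 *ℕ y)) (cong (λ z → + s + z) (pos-* 6 y))
  rhs-homomorphic : + (2 *ℕ a +ℕ 2 *ℕ b +ℕ 2 *ℕ c +ℕ v +ℕ 6 *ℕ x) ≡ + 2 * + a + + 2 * + b + + 2 * + c + + v + + 6 * + x
  rhs-homomorphic = begin
    + (2 *ℕ a +ℕ 2 *ℕ b +ℕ 2 *ℕ c +ℕ v +ℕ 6 *ℕ x)       ≡⟨ pos-+ (2 *ℕ a +ℕ 2 *ℕ b +ℕ 2 *ℕ c +ℕ v) (6 *ℕ x) ⟩
    + (2 *ℕ a +ℕ 2 *ℕ b +ℕ 2 *ℕ c +ℕ v) + + (6 *ℕ x)    ≡⟨ cong₂ _+_ (pos-+ (2 *ℕ a +ℕ 2 *ℕ b +ℕ 2 *ℕ c) v) (pos-* 6 x) ⟩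
    + (2 *ℕ a +ℕ 2 *ℕ b +ℕ 2 *ℕ c) + + v + + 6 * + x    ≡⟨ cong (λ z → z + + v + + 6 * + x) (pos-+ (2 *ℕ a +ℕ 2 *ℕ b) (2 *ℕ c)) ⟩
    + (2 *ℕ a +ℕ 2 *ℕ b) + + (2 *ℕ c) + + v + + 6 * + x ≡⟨ cong₂ (λ z w → z + w + + v + + 6 * + x) (pos-+ (2 *ℕ a) (2 *ℕ b)) (pos-* 2 c) ⟩
    + (2 *ℕ a) + + (2 *ℕ b) + + 2 * + c + + v + + 6 * + x ≡⟨ cong₂ (λ z w → z + w + + 2 * + c + + v + + 6 * + x) (pos-* 2 a) (pos-* 2 b) ⟩
    + 2 * + a + + 2 * + b + + 2 * + c + + v + + 6 * + x   ∎

mainTheorem6 : (n : ℕ) →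
    + sc3 n ≡
    + 2 * + eval1 (deriv (A n))
    + + 2 * + eval1 (deriv (B n))
    + + 2 * + eval1 (deriv (C n))
    + + eval1 (deriv (deriv (deriv (V n))))
    + + 6 * (+ eval11 (derivY (derivQ (F n))) - + eval11 (derivQ (F n)))
mainTheorem6 n
  rewrite eval1-deriv-genPolyOf (occ dduu) (dyck n)
        | eval1-deriv-genPolyOf (occ dudu) (dyck n)
        | eval1-deriv-genPolyOf (occ duuu) (dyck n)
        | eval1-deriv^-genPolyOf 3 valleys (dyck n)
        | eval11-derivY-derivQ-genPoly2Of valleys (occ duu) (dyck n)
        | eval11-derivQ-genPoly2Of valleys (occ duu) (dyck n)
  = ℕ⇒ℤ-identity (sc3 n) (sumDyck n (occ dduu)) (sumDyck n (occ dudu)) (sumDyck n (occ duuu))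
      (sumDyck n (λ w → valleys w ↓ 3)) (sumDyck n (λ w → valleys w *ℕ occ duu w)) (sumDyck n (occ duu))
      (sc3-identity n)
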